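{- Let $G$ be a simple connected graph with $|E(G)|\ge1$ and let $v\in V(G)$. Let $\bar G$ be obtained from $G$ by attaching three new pendant vertices $a,b,c$ to $v$, and let $\widehat G=\bar G+\{a,b\}+\{b,c\}$. Then $\mathscr{K}(\widehat G)>\mathscr{K}(\bar G)$.
   Context: For connected $H$ with $m\ge1$ edges and degrees $d_i$, Kemeny's constant is $\mathscr{K}(H)=\sum_j\pi_jm_{ij}$ for the simple random walk on $H$ ($\pi_j=d_j/2m$, $m_{ij}$ expected hitting time of $j$ from $i$, $m_{jj}=0$), equivalently $\frac1{4m}\sum_{i,j}d_id_jr_H(i,j)$ with $r_H$ effective resistance. $H+\{x,y\}$ denotes $H$ with the edge $\{x,y\}$ added. -}

module Defs where

open import Data.Nat using (ℕ; zero; suc; _+_)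
open import Data.Fin using (Fin; zero; suc; _≟_)
open import Relation.Nullary.Decidable using (isYes)
open import Data.Bool using (Bool; true; false; if_then_else_)
open import Data.Integer using (+_)
open import Data.Rational using (ℚ; 0ℚ; _/_) renaming (_+_ to _+ℚ_; _*_ to _*ℚ_)
open import Data.Product using (Σ; _×_)
open import Relation.Binary.PropositionalEquality using (_≡_; _≢_; refl)

record SimpleGraph (n : ℕ) : Set where
  field
    Adj   : Fin n → Fin n → Bool
    sym   : ∀ i j → Adj i j ≡ Adj j i
    loopless : ∀ i → Adj i i ≡ false
open SimpleGraph public

sumℕ : {n : ℕ} → (Fin n → ℕ) → ℕ
sumℕ {zero}  f = 0
sumℕ {suc n} f = f zero + sumℕ (λ i → f (suc i))

sumℚ : {n : ℕ} → (Fin n → ℚ) → ℚ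
sumℚ {zero}  f = 0ℚ
sumℚ {suc n} f = f zero +ℚ sumℚ (λ i → f (suc i))

toℚ : ℕ → ℚ
toℚ k = + k / 1

deg : {n : ℕ} → SimpleGraph n → Fin n → ℕ
deg G i = sumℕ (λ j → if Adj G i j then 1 else 0)

-- number of edges m(G) = (sum of degrees)/2; we use 2m = sum of degrees
twiceEdges : {n : ℕ} → SimpleGraph n → ℕ
twiceEdges G = sumℕ (deg G)

HasEdge : {n : ℕ} → SimpleGraph n → Set
HasEdge {n} G = Σ (Fin n) λ i → Σ (Fin n) λ j → Adj G i j ≡ true

data Reach {n : ℕ} (G : SimpleGraph n) (i : Fin n) : Fin n → Set where
  here : Reach G i i
  step : ∀ {j k} → Reach G i j → Adj G j k ≡ true → Reach G i k

Connected : {n : ℕ} → SimpleGraph n → Set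
Connected {n} G = ∀ (i j : Fin n) → Reach G i j

-- M i j are the expected hitting times of j from i for the simple random walk:
-- m_jj = 0 and, for i ≠ j, m_ij = 1 + (1/d_i) Σ_{k ~ i} m_kj
-- (first-step analysis; multiplied through by d_i).
IsHittingTimes : {n : ℕ} → SimpleGraph n → (Fin n → Fin n → ℚ) → Set
IsHittingTimes {n} G M =
  (∀ j → M j j ≡ 0ℚ) ×
  (∀ i j → i ≢ j →
     toℚ (deg G i) *ℚ M i j
       ≡ toℚ (deg G i) +ℚ sumℚ (λ k → if Adj G i k then M k j else 0ℚ))

-- κ is Kemeny's constant of G: κ = Σ_j π_j m_ij for every i, with π_j = d_j / 2m
-- (multiplied through by 2m = Σ_j d_j).
IsKemeny : {n : ℕ} → SimpleGraph n → ℚ → Set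
IsKemeny {n} G κ = Σ (Fin n → Fin n → ℚ) λ M →
  IsHittingTimes G M ×
  (∀ i → sumℚ (λ j → toℚ (deg G j) *ℚ M i j) ≡ toℚ (twiceEdges G) *ℚ κ)

-- Ḡ: vertices Fin (3 + n); zero = a, suc zero = b, suc (suc zero) = c,
-- suc (suc (suc i)) = old vertex i. a, b, c are pendant vertices attached to v.
-- Ĝ = Ḡ + {a,b} + {b,c}  (flag extra = true).
isV : {n : ℕ} → Fin n → Fin n → Bool
isV v i = isYes (i ≟ v)

adjExt : {n : ℕ} → SimpleGraph n → Fin n → Bool → Fin (3 + n) → Fin (3 + n) → Bool
adjExt G v e (suc (suc (suc i))) (suc (suc (suc j))) = Adj G i j
adjExt G v e (suc (suc (suc i))) zero = isV v i
adjExt G v e (suc (suc (suc i))) (suc zero) = isV v i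
adjExt G v e (suc (suc (suc i))) (suc (suc zero)) = isV v i
adjExt G v e zero (suc (suc (suc j))) = isV v j
adjExt G v e (suc zero) (suc (suc (suc j))) = isV v j
adjExt G v e (suc (suc zero)) (suc (suc (suc j))) = isV v j
adjExt G v e zero (suc zero) = e
adjExt G v e (suc zero) zero = e
adjExt G v e (suc zero) (suc (suc zero)) = e
adjExt G v e (suc (suc zero)) (suc zero) = e
adjExt G v e zero zero = false
adjExt G v e zero (suc (suc zero)) = false
adjExt G v e (suc zero) (suc zero) = false
adjExt G v e (suc (suc zero)) zero = false
adjExt G v e (suc (suc zero)) (suc (suc zero)) = false

adjExt-sym : {n : ℕ} (G : SimpleGraph n) (v : Fin n) (e : Bool) →
  ∀ x y → adjExt G v e x y ≡ adjExt G v e y x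
adjExt-sym G v e (suc (suc (suc i))) (suc (suc (suc j))) = SimpleGraph.sym G i j
adjExt-sym G v e (suc (suc (suc i))) zero = refl
adjExt-sym G v e (suc (suc (suc i))) (suc zero) = refl
adjExt-sym G v e (suc (suc (suc i))) (suc (suc zero)) = refl
adjExt-sym G v e zero (suc (suc (suc j))) = refl
adjExt-sym G v e (suc zero) (suc (suc (suc j))) = refl
adjExt-sym G v e (suc (suc zero)) (suc (suc (suc j))) = refl
adjExt-sym G v e zero zero = refl
adjExt-sym G v e zero (suc zero) = refl
adjExt-sym G v e zero (suc (suc zero)) = refl
adjExt-sym G v e (suc zero) zero = refl
adjExt-sym G v e (suc zero) (suc zero) = refl
adjExt-sym G v e (suc zero) (suc (suc zero)) = refl
adjExt-sym G v e (suc (suc zero)) zero = refl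
adjExt-sym G v e (suc (suc zero)) (suc zero) = refl
adjExt-sym G v e (suc (suc zero)) (suc (suc zero)) = refl

adjExt-loopless : {n : ℕ} (G : SimpleGraph n) (v : Fin n) (e : Bool) →
  ∀ x → adjExt G v e x x ≡ false
adjExt-loopless G v e (suc (suc (suc i))) = loopless G i
adjExt-loopless G v e zero = refl
adjExt-loopless G v e (suc zero) = refl
adjExt-loopless G v e (suc (suc zero)) = refl

ext : {n : ℕ} → SimpleGraph n → Fin n → Bool → SimpleGraph (3 + n)
ext G v e = record { Adj = adjExt G v e ; sym = adjExt-sym G v e ; loopless = adjExt-loopless G v e }

Gbar : {n : ℕ} → SimpleGraph n → Fin n → SimpleGraph (3 + n)
Gbar G v = ext G v false

Ghat : {n : ℕ} → SimpleGraph n → Fin n → SimpleGraph (3 + n)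
Ghat G v = ext G v true

-- Both graphs are G with a small block on {a, b, c} glued at v, written V below. Put
-- E = 2|E(G)|, so that twice the number of edges is E + 6 in Ḡ and E + 10 in Ĝ.
-- A column of hitting times is determined by the first-step equations L Φ = s·d away from
-- its target (L the graph Laplacian, d the degrees) together with Φ = 0 at the target: by
-- the minimum principle, a harmonic function on a connected graph that vanishes at one
-- vertex vanishes everywhere. This expresses the hitting times of Ĝ out of a through those
-- of Ḡ: a combination of two columns of M̄ still solves the equations of Ĝ on the vertices
-- of G, provided its values on a, b, c are re-chosen to absorb the defect that Kac's formula
-- leaves at V. Evaluating Kemeny's constant along the row of a in both graphs gives
--   4 (E + 6) (E + 10) (κ̂ - κ̄) = (E - 2) (4E + 18) + 16 Σᵢ dᵢ M̄(i, V),
-- which is positive because E ≥ 2 and some vertex i ≠ v of G has dᵢ M̄(i, V) ≥ 1.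

module Submission where

open import Defs hiding (sym)
open import Algebra.Bundles using (CommutativeRing)
open import Function using (_∘_)
open import Data.Bool using (Bool; true; false; if_then_else_)
open import Data.Empty using (⊥-elim)
open import Data.Product using (_,_; proj₁; proj₂)
open import Data.Sum using (_⊎_; inj₁; inj₂)
open import Data.Nat as ℕ using (ℕ; zero; suc)
open import Data.Fin as Fin using (Fin; zero; suc; punchIn; punchOut; _↑ˡ_)
open import Data.Fin.Properties using (punchIn-punchOut)
open import Data.Vec.Functional using (removeAt)
open import Data.List using (allFin)
open import Data.List.Relation.Unary.All as All using ()
open import Data.List.Membership.Propositional.Properties using (∈-allFin)
import Data.List.Extrema
open import Data.Integer as ℤ using ()
import Data.Integer.Properties as ℤP
import Data.Nat.Coprimality as Coprime
open import Data.Rational as ℚ using (ℚ; mkℚ; 0ℚ; 1ℚ; ½; _+_; _*_; _-_; -_; _≤_; _<_)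
import Data.Rational.Properties as ℚP
open import Algebra.Properties.Semiring.Sum (CommutativeRing.semiring ℚP.+-*-commutativeRing)
  using (sum; sum-syntax; sum-replicate-zero; sum-cong-≗; ∑-distrib-+; ∑-comm; *-distribˡ-sum; sum-remove)
open import Data.Rational.Solver using (module +-*-Solver)
open +-*-Solver using (solve; _:=_; con; _:+_; _:*_; _:-_; :-_)
open import Relation.Nullary using (Dec; yes; no)
open import Relation.Binary.Bundles using (DecTotalOrder)
open import Relation.Binary.PropositionalEquality hiding (J)

p≤p+q : ∀ {p q} → 0ℚ ≤ q → p ≤ p + q
p≤p+q {p} 0≤q = subst (_≤ p + _) (ℚP.+-identityʳ p) (ℚP.+-monoʳ-≤ p 0≤q)

p≤q⇒p-q≤0 : ∀ {p q} → p ≤ q → p - q ≤ 0ℚ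
p≤q⇒p-q≤0 {p} {q} p≤q = subst (p - q ≤_) (ℚP.+-inverseʳ q) (ℚP.+-monoˡ-≤ (- q) p≤q)

p≤q⇒0≤q-p : ∀ {p q} → p ≤ q → 0ℚ ≤ q - p
p≤q⇒0≤q-p {p} {q} p≤q = subst (_≤ q - p) (ℚP.+-inverseʳ p) (ℚP.+-monoˡ-≤ (- p) p≤q)

*-nonneg : ∀ {p q} → 0ℚ ≤ p → 0ℚ ≤ q → 0ℚ ≤ p * q
*-nonneg {p} {q} 0≤p 0≤q =
  ℚP.nonNegative⁻¹ (p * q) {{ℚP.nonNeg*nonNeg⇒nonNeg p {{ℚ.nonNegative 0≤p}} q {{ℚ.nonNegative 0≤q}}}}

gap⇒< : ∀ {k g p q} → 0ℚ ≤ k → 0ℚ < g → k * p + g ≡ k * q → p < q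
gap⇒< {k} {g} {p} 0≤k 0<g kp+g≡kq = ℚP.*-cancelˡ-<-nonNeg k {{ℚ.nonNegative 0≤k}}
  (subst₂ _<_ (ℚP.+-identityʳ (k * p)) kp+g≡kq (ℚP.+-monoʳ-< (k * p) 0<g))

toℚ-mkℚ : ∀ k → toℚ k ≡ mkℚ (ℤ.+ k) 0 (Coprime.sym (Coprime.1-coprimeTo k))
toℚ-mkℚ k = ℚP.normalize-coprime (Coprime.sym (Coprime.1-coprimeTo k))

toℚ-+ : ∀ k l → toℚ (k ℕ.+ l) ≡ toℚ k + toℚ l
toℚ-+ k l rewrite toℚ-mkℚ k | toℚ-mkℚ l | ℤP.*-identityʳ (ℤ.+ k) | ℤP.*-identityʳ (ℤ.+ l) = refl

sumℚ≡∑ : ∀ {n} (f : Fin n → ℚ) → sumℚ f ≡ ∑[ i < n ] f i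
sumℚ≡∑ {zero} f = refl
sumℚ≡∑ {suc n} f = cong (f zero +_) (sumℚ≡∑ (f ∘ suc))

toℚ-sumℕ : ∀ {n} (f : Fin n → ℕ) → toℚ (sumℕ f) ≡ ∑[ i < n ] toℚ (f i)
toℚ-sumℕ {zero} f = refl
toℚ-sumℕ {suc n} f = trans (toℚ-+ (f zero) _) (cong (toℚ (f zero) +_) (toℚ-sumℕ (f ∘ suc)))

isV-self : ∀ {n} (v : Fin n) → isV v v ≡ true
isV-self v with v Fin.≟ v
... | yes _ = refl
... | no v≢v = ⊥-elim (v≢v refl)

isV-other : ∀ {n} {v x : Fin n} → x ≢ v → isV v x ≡ false
isV-other {v = v} {x} x≢v with x Fin.≟ v
... | yes x≡v = ⊥-elim (x≢v x≡v)
... | no _ = refl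

∑-indicator : ∀ {n} (v : Fin n) (f : Fin n → ℚ) → ∑[ k < n ] (if isV v k then f k else 0ℚ) ≡ f v
∑-indicator {suc n} zero f = trans (cong (f zero +_) (sum-replicate-zero n)) (ℚP.+-identityʳ (f zero))
∑-indicator {suc n} (suc v) f = trans (ℚP.+-identityˡ _) (trans (sum-cong-≗ shift) (∑-indicator v (f ∘ suc)))
  where
  shift : ∀ k → (if isV (suc v) (suc k) then f (suc k) else 0ℚ) ≡ (if isV v k then f (suc k) else 0ℚ)
  shift k with k Fin.≟ v
  ... | yes _ = refl
  ... | no _ = refl

∑-mono-≤ : ∀ {n} {f g : Fin n → ℚ} → (∀ k → f k ≤ g k) → ∑[ k < n ] f k ≤ ∑[ k < n ] g k
∑-mono-≤ {zero} f≤g = ℚP.≤-refl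
∑-mono-≤ {suc n} f≤g = ℚP.+-mono-≤ (f≤g zero) (∑-mono-≤ (f≤g ∘ suc))

∑-nonneg : ∀ {n} {f : Fin n → ℚ} → (∀ k → 0ℚ ≤ f k) → 0ℚ ≤ ∑[ k < n ] f k
∑-nonneg {n} {f} 0≤f = subst (_≤ sum f) (sum-replicate-zero n) (∑-mono-≤ 0≤f)

term≤∑ : ∀ {n} {f : Fin n → ℚ} → (∀ k → 0ℚ ≤ f k) → ∀ i → f i ≤ ∑[ k < n ] f k
term≤∑ {suc n} {f} 0≤f i =
  subst (f i ≤_) (sym (sum-remove {i = i} f)) (p≤p+q (∑-nonneg (0≤f ∘ punchIn i)))

pair≤∑ : ∀ {n} {f : Fin n → ℚ} → (∀ k → 0ℚ ≤ f k) →
         ∀ {i j} → i ≢ j → f i + f j ≤ ∑[ k < n ] f k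
pair≤∑ {suc n} {f} 0≤f {i} {j} i≢j = subst (f i + f j ≤_) (sym (sum-remove {i = i} f))
  (ℚP.+-monoʳ-≤ (f i) (subst (_≤ sum (removeAt f i)) (cong f (punchIn-punchOut i≢j))
    (term≤∑ (0≤f ∘ punchIn i) (punchOut i≢j))))

∑-linear : ∀ {n} α β γ (f g h : Fin n → ℚ) →
           ∑[ i < n ] (α * f i + β * g i + γ * h i) ≡ α * sum f + β * sum g + γ * sum h
∑-linear α β γ f g h = trans (∑-distrib-+ (λ i → α * f i + β * g i) (λ i → γ * h i))
  (cong₂ _+_ (trans (∑-distrib-+ (λ i → α * f i) (λ i → β * g i))
                    (cong₂ _+_ (sym (*-distribˡ-sum α f)) (sym (*-distribˡ-sum β g))))
             (sym (*-distribˡ-sum γ h)))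

∑-nonpositive : ∀ {n} {f : Fin n → ℚ} → (∀ k → f k ≤ 0ℚ) → ∑[ k < n ] f k ≤ 0ℚ
∑-nonpositive {n} {f} f≤0 = subst (sum f ≤_) (sum-replicate-zero n) (∑-mono-≤ f≤0)

∑-nonpositive-zero : ∀ {n} {f : Fin n → ℚ} → (∀ k → f k ≤ 0ℚ) → 0ℚ ≤ ∑[ k < n ] f k →
                     ∀ k → f k ≡ 0ℚ
∑-nonpositive-zero {suc n} {f} f≤0 0≤∑ k = ℚP.≤-antisym (f≤0 k) (begin
  0ℚ                        ≤⟨ 0≤∑ ⟩
  ∑[ i < suc n ] f i        ≡⟨ sum-remove {i = k} f ⟩
  f k + sum (removeAt f k)  ≤⟨ ℚP.+-monoʳ-≤ (f k) (∑-nonpositive (f≤0 ∘ punchIn k)) ⟩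
  f k + 0ℚ                  ≡⟨ ℚP.+-identityʳ (f k) ⟩
  f k                       ∎)
  where open ℚP.≤-Reasoning

∑-except : ∀ {n} {f g : Fin n → ℚ} (j : Fin n) → (∀ x → x ≢ j → f x ≡ g x) →
           ∑[ x < n ] f x ≡ ∑[ x < n ] g x + (f j - g j)
∑-except {n} {f} {g} j f≡g = begin
  ∑[ x < n ] f x                                                   ≡⟨ sum-cong-≗ correction ⟩
  ∑[ x < n ] (g x + (if isV j x then f j - g j else 0ℚ))           ≡⟨ ∑-distrib-+ g _ ⟩
  ∑[ x < n ] g x + ∑[ x < n ] (if isV j x then f j - g j else 0ℚ)  ≡⟨ cong (sum g +_) (∑-indicator j (λ _ → f j - g j)) ⟩
  ∑[ x < n ] g x + (f j - g j)                                     ∎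
  where
  open ≡-Reasoning
  add-difference : ∀ a b → a ≡ b + (a - b)
  add-difference = solve 2 (λ a b → a := b :+ (a :- b)) refl
  correction : ∀ x → f x ≡ g x + (if isV j x then f j - g j else 0ℚ)
  correction x with x Fin.≟ j
  ... | yes refl = add-difference (f x) (g x)
  ... | no x≢j = trans (f≡g x x≢j) (sym (ℚP.+-identityʳ (g x)))

Reach-trans : ∀ {n} {H : SimpleGraph n} {x y z} → Reach H x y → Reach H y z → Reach H x z
Reach-trans x⇝y here = x⇝y
Reach-trans x⇝y (step y⇝z z~w) = step (Reach-trans x⇝y y⇝z) z~w

-- The Laplacian of a simple graph

module _ {n : ℕ} (H : SimpleGraph n) where

  adjSum : Fin n → (Fin n → ℚ) → ℚ
  adjSum x F = ∑[ k < n ] (if Adj H x k then F k else 0ℚ)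

  laplacian : (Fin n → ℚ) → Fin n → ℚ
  laplacian F x = adjSum x (λ k → F x - F k)

  -- The first-step equations, in Laplacian form, satisfied by s times the hitting times of j.
  HittingEquations : Fin n → ℚ → (Fin n → ℚ) → Set
  HittingEquations j s Φ = ∀ x → x ≢ j → laplacian Φ x ≡ s * toℚ (deg H x)

  adjSum-cong : ∀ x {F G} → (∀ k → F k ≡ G k) → adjSum x F ≡ adjSum x G
  adjSum-cong x F≗G = sum-cong-≗ (λ k → cong (if Adj H x k then_else 0ℚ) (F≗G k))

  adjSum-+ : ∀ x F G → adjSum x (λ k → F k + G k) ≡ adjSum x F + adjSum x G
  adjSum-+ x F G = trans (sum-cong-≗ (λ k → split (Adj H x k)))
    (∑-distrib-+ (λ k → if Adj H x k then F k else 0ℚ) (λ k → if Adj H x k then G k else 0ℚ))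
    where
    split : ∀ b {k} → (if b then F k + G k else 0ℚ) ≡ (if b then F k else 0ℚ) + (if b then G k else 0ℚ)
    split true = refl
    split false = refl

  adjSum-* : ∀ x c F → adjSum x (λ k → c * F k) ≡ c * adjSum x F
  adjSum-* x c F = trans (sum-cong-≗ (λ k → pull (Adj H x k)))
    (sym (*-distribˡ-sum c (λ k → if Adj H x k then F k else 0ℚ)))
    where
    pull : ∀ b {k} → (if b then c * F k else 0ℚ) ≡ c * (if b then F k else 0ℚ)
    pull true = refl
    pull false = sym (ℚP.*-zeroʳ c)

  toℚ-deg : ∀ x → toℚ (deg H x) ≡ adjSum x (λ _ → 1ℚ)
  toℚ-deg x = trans (toℚ-sumℕ (λ k → if Adj H x k then 1 else 0)) (sum-cong-≗ (λ k → indicator (Adj H x k)))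
    where
    indicator : ∀ b → toℚ (if b then 1 else 0) ≡ (if b then 1ℚ else 0ℚ)
    indicator true = refl
    indicator false = refl

  adjSum-const : ∀ x c → adjSum x (λ _ → c) ≡ c * toℚ (deg H x)
  adjSum-const x c = begin
    adjSum x (λ _ → c)       ≡⟨ adjSum-cong x (λ _ → sym (ℚP.*-identityʳ c)) ⟩
    adjSum x (λ _ → c * 1ℚ)  ≡⟨ adjSum-* x c (λ _ → 1ℚ) ⟩
    c * adjSum x (λ _ → 1ℚ)  ≡⟨ cong (c *_) (sym (toℚ-deg x)) ⟩
    c * toℚ (deg H x)        ∎
    where open ≡-Reasoning

  adjSum-nonneg : ∀ x {F} → (∀ k → 0ℚ ≤ F k) → 0ℚ ≤ adjSum x F
  adjSum-nonneg x {F} 0≤F = ∑-nonneg nonneg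
    where
    nonneg : ∀ k → 0ℚ ≤ (if Adj H x k then F k else 0ℚ)
    nonneg k with Adj H x k
    ... | true = 0≤F k
    ... | false = ℚP.≤-refl

  degree-nonneg : ∀ x → 0ℚ ≤ toℚ (deg H x)
  degree-nonneg x = subst (0ℚ ≤_) (sym (toℚ-deg x)) (adjSum-nonneg x (λ _ → ℚP.nonNegative⁻¹ 1ℚ))

  degree-positive : ∀ {x y} → Adj H x y ≡ true → 1ℚ ≤ toℚ (deg H x)
  degree-positive {x} {y} x~y = subst₂ _≤_ (cong (if_then 1ℚ else 0ℚ) x~y) (sym (toℚ-deg x))
    (term≤∑ (λ k → indicator-nonneg (Adj H x k)) y)
    where
    indicator-nonneg : ∀ b → 0ℚ ≤ (if b then 1ℚ else 0ℚ)
    indicator-nonneg true = ℚP.nonNegative⁻¹ 1ℚ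
    indicator-nonneg false = ℚP.≤-refl

  laplacian-degree : ∀ F x → laplacian F x ≡ toℚ (deg H x) * F x - adjSum x F
  laplacian-degree F x = begin
    adjSum x (λ k → F x - F k)                          ≡⟨ adjSum-cong x (λ k → as-sum (F x) (F k)) ⟩
    adjSum x (λ k → F x + - 1ℚ * F k)                   ≡⟨ adjSum-+ x (λ _ → F x) (λ k → - 1ℚ * F k) ⟩
    adjSum x (λ _ → F x) + adjSum x (λ k → - 1ℚ * F k)  ≡⟨ cong₂ _+_ (adjSum-const x (F x)) (adjSum-* x (- 1ℚ) F) ⟩
    F x * toℚ (deg H x) + - 1ℚ * adjSum x F             ≡⟨ rearrange (F x) (toℚ (deg H x)) (adjSum x F) ⟩
    toℚ (deg H x) * F x - adjSum x F                    ∎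
    where
    open ≡-Reasoning
    as-sum : ∀ a b → a - b ≡ a + - 1ℚ * b
    as-sum = solve 2 (λ a b → a :- b := a :+ :- con 1ℚ :* b) refl
    rearrange : ∀ f d s → f * d + - 1ℚ * s ≡ d * f - s
    rearrange = solve 3 (λ f d s → f :* d :+ :- con 1ℚ :* s := d :* f :- s) refl

  laplacian-+ : ∀ F G x → laplacian (λ y → F y + G y) x ≡ laplacian F x + laplacian G x
  laplacian-+ F G x = trans (adjSum-cong x (λ k → regroup (F x) (G x) (F k) (G k)))
                            (adjSum-+ x (λ k → F x - F k) (λ k → G x - G k))
    where
    regroup : ∀ a b c d → (a + b) - (c + d) ≡ (a - c) + (b - d)
    regroup = solve 4 (λ a b c d → (a :+ b) :- (c :+ d) := (a :- c) :+ (b :- d)) refl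

  laplacian-* : ∀ c F x → laplacian (λ y → c * F y) x ≡ c * laplacian F x
  laplacian-* c F x = trans (adjSum-cong x (λ k → factor c (F x) (F k))) (adjSum-* x c (λ k → F x - F k))
    where
    factor : ∀ c a b → c * a - c * b ≡ c * (a - b)
    factor = solve 3 (λ c a b → c :* a :- c :* b := c :* (a :- b)) refl

  laplacian-const : ∀ c x → laplacian (λ _ → c) x ≡ 0ℚ
  laplacian-const c x = begin
    adjSum x (λ _ → c - c)  ≡⟨ adjSum-cong x (λ _ → ℚP.+-inverseʳ c) ⟩
    adjSum x (λ _ → 0ℚ)     ≡⟨ adjSum-const x 0ℚ ⟩
    0ℚ * toℚ (deg H x)      ≡⟨ ℚP.*-zeroˡ (toℚ (deg H x)) ⟩
    0ℚ                      ∎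
    where open ≡-Reasoning

  laplacian-affine : ∀ β F γ x → laplacian (λ y → β * F y + γ) x ≡ β * laplacian F x
  laplacian-affine β F γ x = begin
    laplacian (λ y → β * F y + γ) x                      ≡⟨ laplacian-+ (λ y → β * F y) (λ _ → γ) x ⟩
    laplacian (λ y → β * F y) x + laplacian (λ _ → γ) x  ≡⟨ cong₂ _+_ (laplacian-* β F x) (laplacian-const γ x) ⟩
    β * laplacian F x + 0ℚ                               ≡⟨ ℚP.+-identityʳ _ ⟩
    β * laplacian F x                                    ∎
    where open ≡-Reasoning

  -- Each edge contributes F x - F k at x and F k - F x at k.
  ∑-laplacian : ∀ F → ∑[ x < n ] laplacian F x ≡ 0ℚ
  ∑-laplacian F = self-negating (begin
    S                                     ≡⟨ ∑-comm T ⟩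
    ∑[ k < n ] ∑[ x < n ] T x k           ≡⟨ sum-cong-≗ (λ k → sum-cong-≗ (λ x → antisymmetric x k)) ⟩
    ∑[ k < n ] ∑[ x < n ] (- 1ℚ * T k x)  ≡⟨ sum-cong-≗ (λ k → sym (*-distribˡ-sum (- 1ℚ) (T k))) ⟩
    ∑[ k < n ] (- 1ℚ * ∑[ x < n ] T k x)  ≡⟨ sym (*-distribˡ-sum (- 1ℚ) (λ k → sum (T k))) ⟩
    - 1ℚ * S                              ∎)
    where
    open ≡-Reasoning
    T : Fin n → Fin n → ℚ
    T x k = if Adj H x k then F x - F k else 0ℚ
    S : ℚ
    S = ∑[ x < n ] ∑[ k < n ] T x k
    antisymmetric : ∀ x k → T x k ≡ - 1ℚ * T k x
    antisymmetric x k rewrite SimpleGraph.sym H x k with Adj H k x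
    ... | true = flip (F x) (F k)
      where
      flip : ∀ a b → a - b ≡ - 1ℚ * (b - a)
      flip = solve 2 (λ a b → a :- b := :- con 1ℚ :* (b :- a)) refl
    ... | false = refl
    self-negating : S ≡ - 1ℚ * S → S ≡ 0ℚ
    self-negating S≡-S = begin
      S                   ≡⟨ halve S ⟩
      ½ * (S + S)         ≡⟨ cong (λ t → ½ * (S + t)) S≡-S ⟩
      ½ * (S + - 1ℚ * S)  ≡⟨ cancel S ⟩
      0ℚ                  ∎
      where
      halve : ∀ s → s ≡ ½ * (s + s)
      halve = solve 1 (λ s → s := con ½ :* (s :+ s)) refl
      cancel : ∀ s → ½ * (s + - 1ℚ * s) ≡ 0ℚ
      cancel = solve 1 (λ s → con ½ :* (s :+ :- con 1ℚ :* s) := con 0ℚ) refl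

  laplacian-at-minimum : ∀ F y → (∀ k → F y ≤ F k) → 0ℚ ≤ laplacian F y →
                         ∀ {z} → Adj H y z ≡ true → F z ≡ F y
  laplacian-at-minimum F y minimal 0≤L {z} y~z = begin
    F z                ≡⟨ difference-zero (F z) (F y) ⟩
    F y - (F y - F z)  ≡⟨ cong (λ t → F y - t) edge-term-zero ⟩
    F y - 0ℚ           ≡⟨ minus-zero (F y) ⟩
    F y                ∎
    where
    open ≡-Reasoning
    nonpositive : ∀ k → (if Adj H y k then F y - F k else 0ℚ) ≤ 0ℚ
    nonpositive k with Adj H y k
    ... | true = p≤q⇒p-q≤0 (minimal k)
    ... | false = ℚP.≤-refl
    edge-term-zero : F y - F z ≡ 0ℚ
    edge-term-zero = subst (λ b → (if b then F y - F z else 0ℚ) ≡ 0ℚ) y~z (∑-nonpositive-zero nonpositive 0≤L z)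
    difference-zero : ∀ a b → a ≡ b - (b - a)
    difference-zero = solve 2 (λ a b → a := b :- (b :- a)) refl
    minus-zero : ∀ a → a - 0ℚ ≡ a
    minus-zero = solve 1 (λ a → a :- con 0ℚ := a) refl

  minimum-principle : Connected H → ∀ {F j} → (∀ x → x ≢ j → 0ℚ ≤ laplacian F x) → ∀ x → F j ≤ F x
  minimum-principle connected {F} {j} superharmonic x = subst (_≤ F x) (sym Fj≡μ) (minimal x)
    where
    open Data.List.Extrema (DecTotalOrder.totalOrder ℚP.≤-decTotalOrder)
    y₀ : Fin n
    y₀ = argmin F j (allFin n)
    μ : ℚ
    μ = F y₀
    minimal : ∀ k → μ ≤ F k
    minimal k = All.lookup (f[argmin]≤f[xs] {f = F} j (allFin n)) (∈-allFin k)
    -- The minimum spreads from every minimiser other than j to its neighbours.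
    spread : ∀ {z} → Reach H y₀ z → F j ≡ μ ⊎ F z ≡ μ
    spread here = inj₂ refl
    spread (step {y} y₀⇝y y~z) with spread y₀⇝y
    ... | inj₁ Fj≡μ = inj₁ Fj≡μ
    ... | inj₂ Fy≡μ with y Fin.≟ j
    ...   | yes refl = inj₁ Fy≡μ
    ...   | no y≢j = inj₂ (trans (laplacian-at-minimum F y y-minimal (superharmonic y y≢j) y~z) Fy≡μ)
      where
      y-minimal : ∀ k → F y ≤ F k
      y-minimal k = subst (_≤ F k) (sym Fy≡μ) (minimal k)
    Fj≡μ : F j ≡ μ
    Fj≡μ with spread (connected y₀ j)
    ... | inj₁ Fj≡μ = Fj≡μ
    ... | inj₂ Fj≡μ = Fj≡μ

  harmonic-zero : Connected H → ∀ {D j} → D j ≡ 0ℚ → (∀ x → x ≢ j → laplacian D x ≡ 0ℚ) →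
                  ∀ x → D x ≡ 0ℚ
  harmonic-zero connected {D} {j} Dj≡0 harmonic x = ℚP.≤-antisym D≤0 0≤D
    where
    0≤D : 0ℚ ≤ D x
    0≤D = subst (_≤ D x) Dj≡0
            (minimum-principle connected (λ y y≢j → ℚP.≤-reflexive (sym (harmonic y y≢j))) x)
    -D-superharmonic : ∀ y → y ≢ j → 0ℚ ≤ laplacian (λ z → - 1ℚ * D z) y
    -D-superharmonic y y≢j =
      ℚP.≤-reflexive (sym (trans (laplacian-* (- 1ℚ) D y) (cong (- 1ℚ *_) (harmonic y y≢j))))
    D≤0 : D x ≤ 0ℚ
    D≤0 = subst₂ _≤_ (double-negation (D x)) refl
            (ℚP.neg-antimono-≤ (subst (λ d → - 1ℚ * d ≤ - 1ℚ * D x) Dj≡0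
              (minimum-principle connected -D-superharmonic x)))
      where
      double-negation : ∀ d → - (- 1ℚ * d) ≡ d
      double-negation = solve 1 (λ d → :- (:- con 1ℚ :* d) := d) refl

  -- Hitting times

  module _ {M : Fin n → Fin n → ℚ} (hitting : IsHittingTimes H M) where

    first-step : ∀ {x j} → x ≢ j → toℚ (deg H x) * M x j ≡ toℚ (deg H x) + adjSum x (λ y → M y j)
    first-step {x} {j} x≢j = trans (proj₂ hitting x j x≢j)
      (cong (toℚ (deg H x) +_) (sumℚ≡∑ (λ k → if Adj H x k then M k j else 0ℚ)))

    hitting-equations : ∀ j → HittingEquations j 1ℚ (λ y → M y j)
    hitting-equations j x x≢j = begin
      laplacian (λ y → M y j) x                                        ≡⟨ laplacian-degree (λ y → M y j) x ⟩
      toℚ (deg H x) * M x j - adjSum x (λ y → M y j)                   ≡⟨ cong (_- adjSum x (λ y → M y j)) (first-step x≢j) ⟩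
      toℚ (deg H x) + adjSum x (λ y → M y j) - adjSum x (λ y → M y j)  ≡⟨ cancel (toℚ (deg H x)) (adjSum x (λ y → M y j)) ⟩
      1ℚ * toℚ (deg H x)                                               ∎
      where
      open ≡-Reasoning
      cancel : ∀ d s → d + s - s ≡ 1ℚ * d
      cancel = solve 2 (λ d s → d :+ s :- s := con 1ℚ :* d) refl

    -- Kac's formula: the mean return time to j is 2m / d_j.
    laplacian-at-target : ∀ j → laplacian (λ y → M y j) j ≡ toℚ (deg H j) - toℚ (twiceEdges H)
    laplacian-at-target j = begin
      L j
        ≡⟨ rearrange (L j) (toℚ (deg H j)) (toℚ (twiceEdges H)) ⟩
      toℚ (twiceEdges H) + (L j - toℚ (deg H j)) + (toℚ (deg H j) - toℚ (twiceEdges H))  ≡⟨ cong (_+ _) total ⟨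
      0ℚ + (toℚ (deg H j) - toℚ (twiceEdges H))                                          ≡⟨ ℚP.+-identityˡ _ ⟩
      toℚ (deg H j) - toℚ (twiceEdges H)                                                 ∎
      where
      open ≡-Reasoning
      L : Fin n → ℚ
      L = laplacian (λ y → M y j)
      total : 0ℚ ≡ toℚ (twiceEdges H) + (L j - toℚ (deg H j))
      total = begin
        0ℚ                                                ≡⟨ ∑-laplacian (λ y → M y j) ⟨
        ∑[ x < n ] L x
          ≡⟨ ∑-except j (λ x x≢j → trans (hitting-equations j x x≢j) (ℚP.*-identityˡ _)) ⟩
        ∑[ x < n ] toℚ (deg H x) + (L j - toℚ (deg H j))  ≡⟨ cong (_+ (L j - toℚ (deg H j))) (toℚ-sumℕ (deg H)) ⟨
        toℚ (twiceEdges H) + (L j - toℚ (deg H j))        ∎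
      rearrange : ∀ l d m → l ≡ m + (l - d) + (d - m)
      rearrange = solve 3 (λ l d m → l := m :+ (l :- d) :+ (d :- m)) refl

    module _ (connected : Connected H) where

      hitting-unique : ∀ {j s Φ} → HittingEquations j s Φ → Φ j ≡ 0ℚ → ∀ x → Φ x ≡ s * M x j
      hitting-unique {j} {s} {Φ} equations Φj≡0 x = begin
        Φ x              ≡⟨ shift (Φ x) s (M x j) ⟩
        D x + s * M x j  ≡⟨ cong (_+ s * M x j) (harmonic-zero connected {D} Dj≡0 D-harmonic x) ⟩
        0ℚ + s * M x j   ≡⟨ ℚP.+-identityˡ _ ⟩
        s * M x j        ∎
        where
        open ≡-Reasoning
        D : Fin n → ℚ
        D y = Φ y + - s * M y j
        Dj≡0 : D j ≡ 0ℚ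
        Dj≡0 rewrite Φj≡0 | proj₁ hitting j = cong (0ℚ +_) (ℚP.*-zeroʳ (- s))
        D-harmonic : ∀ y → y ≢ j → laplacian D y ≡ 0ℚ
        D-harmonic y y≢j = begin
          laplacian D y                                    ≡⟨ laplacian-+ Φ (λ z → - s * M z j) y ⟩
          laplacian Φ y + laplacian (λ z → - s * M z j) y  ≡⟨ cong (laplacian Φ y +_) (laplacian-* (- s) (λ z → M z j) y) ⟩
          laplacian Φ y + - s * laplacian (λ z → M z j) y
            ≡⟨ cong₂ (λ p q → p + - s * q) (equations y y≢j) (hitting-equations j y y≢j) ⟩
          s * toℚ (deg H y) + - s * (1ℚ * toℚ (deg H y))   ≡⟨ cancel s (toℚ (deg H y)) ⟩
          0ℚ                                               ∎
          where
          cancel : ∀ s d → s * d + - s * (1ℚ * d) ≡ 0ℚ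
          cancel = solve 2 (λ s d → s :* d :+ :- s :* (con 1ℚ :* d) := con 0ℚ) refl
        shift : ∀ φ s m → φ ≡ φ + - s * m + s * m
        shift = solve 3 (λ φ s m → φ := φ :+ :- s :* m :+ s :* m) refl

      hitting-nonneg : ∀ x j → 0ℚ ≤ M x j
      hitting-nonneg x j = subst (_≤ M x j) (proj₁ hitting j) (minimum-principle connected superharmonic x)
        where
        superharmonic : ∀ y → y ≢ j → 0ℚ ≤ laplacian (λ z → M z j) y
        superharmonic y y≢j = subst (0ℚ ≤_) (sym (trans (hitting-equations j y y≢j) (ℚP.*-identityˡ _)))
                                    (degree-nonneg y)

      degree≤degree*hitting : ∀ {x j} → x ≢ j → toℚ (deg H x) ≤ toℚ (deg H x) * M x j
      degree≤degree*hitting {x} {j} x≢j = subst (toℚ (deg H x) ≤_) (sym (first-step x≢j))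
        (p≤p+q (adjSum-nonneg x (λ k → hitting-nonneg k j)))

-- Three new vertices attached at v

module Pendants {n : ℕ} (G : SimpleGraph n) (v : Fin n) where

  a b c : Fin (3 ℕ.+ n)
  a = zero
  b = suc zero
  c = suc (suc zero)

  old : Fin n → Fin (3 ℕ.+ n)
  old i = suc (suc (suc i))

  V : Fin (3 ℕ.+ n)
  V = old v

  E : ℚ
  E = toℚ (twiceEdges G)

  new : Fin 3 → Fin (3 ℕ.+ n)
  new x = x ↑ˡ n

  Ḡ Ĝ : SimpleGraph (3 ℕ.+ n)
  Ḡ = Gbar G v
  Ĝ = Ghat G v

  old-injective : ∀ {i j} → old i ≡ old j → i ≡ j
  old-injective refl = refl

  new≢old : ∀ x {i} → new x ≢ old i
  new≢old zero ()
  new≢old (suc zero) ()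
  new≢old (suc (suc zero)) ()

  module _ (e : Bool) where

    adjSum-old : ∀ {i} → i ≢ v → ∀ F → adjSum (ext G v e) (old i) F ≡ adjSum G i (F ∘ old)
    adjSum-old {i} i≢v F rewrite isV-other i≢v =
      trans (ℚP.+-identityˡ _) (trans (ℚP.+-identityˡ _) (ℚP.+-identityˡ _))

    adjSum-V : ∀ F → adjSum (ext G v e) V F ≡ F a + (F b + (F c + adjSum G v (F ∘ old)))
    adjSum-V F rewrite isV-self v = refl

    laplacian-old : ∀ {i} → i ≢ v → ∀ F → laplacian (ext G v e) F (old i) ≡ laplacian G (F ∘ old) i
    laplacian-old {i} i≢v F = adjSum-old i≢v (λ k → F (old i) - F k)

    laplacian-V : ∀ F → laplacian (ext G v e) F V ≡
                  (F V - F a) + ((F V - F b) + ((F V - F c) + laplacian G (F ∘ old) v))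
    laplacian-V F = adjSum-V (λ k → F V - F k)

    toℚ-deg-old : ∀ {i} → i ≢ v → toℚ (deg (ext G v e) (old i)) ≡ toℚ (deg G i)
    toℚ-deg-old {i} i≢v =
      trans (toℚ-deg (ext G v e) (old i)) (trans (adjSum-old i≢v (λ _ → 1ℚ)) (sym (toℚ-deg G i)))

    toℚ-deg-V : toℚ (deg (ext G v e) V) ≡ toℚ 3 + toℚ (deg G v)
    toℚ-deg-V = begin
      toℚ (deg (ext G v e) V)                   ≡⟨ toℚ-deg (ext G v e) V ⟩
      adjSum (ext G v e) V (λ _ → 1ℚ)           ≡⟨ adjSum-V (λ _ → 1ℚ) ⟩
      1ℚ + (1ℚ + (1ℚ + adjSum G v (λ _ → 1ℚ)))  ≡⟨ three (adjSum G v (λ _ → 1ℚ)) ⟩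
      toℚ 3 + adjSum G v (λ _ → 1ℚ)             ≡⟨ cong (toℚ 3 +_) (toℚ-deg G v) ⟨
      toℚ 3 + toℚ (deg G v)                     ∎
      where
      open ≡-Reasoning
      three : ∀ d → 1ℚ + (1ℚ + (1ℚ + d)) ≡ toℚ 3 + d
      three = solve 1 (λ d → con 1ℚ :+ (con 1ℚ :+ (con 1ℚ :+ d)) := con (toℚ 3) :+ d) refl

    ∑-deg-old : ∑[ i < n ] toℚ (deg (ext G v e) (old i)) ≡ E + toℚ 3
    ∑-deg-old = begin
      ∑[ i < n ] toℚ (deg (ext G v e) (old i))     ≡⟨ ∑-except v (λ i i≢v → toℚ-deg-old i≢v) ⟩
      ∑[ i < n ] toℚ (deg G i) + (toℚ (deg (ext G v e) V) - toℚ (deg G v))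
        ≡⟨ cong₂ _+_ (sym (toℚ-sumℕ (deg G))) (cong (_- toℚ (deg G v)) toℚ-deg-V) ⟩
      E + (toℚ 3 + toℚ (deg G v) - toℚ (deg G v))  ≡⟨ cancel E (toℚ (deg G v)) ⟩
      E + toℚ 3                                    ∎
      where
      open ≡-Reasoning
      cancel : ∀ m d → m + (toℚ 3 + d - d) ≡ m + toℚ 3
      cancel = solve 2 (λ m d → m :+ (con (toℚ 3) :+ d :- d) := m :+ con (toℚ 3)) refl

    lift : ∀ {i j} → Reach G i j → Reach (ext G v e) (old i) (old j)
    lift here = here
    lift (step i⇝j j~k) = step (lift i⇝j) j~k

    connected-ext : Connected G → Connected (ext G v e)
    connected-ext connected x y = Reach-trans (to-V x) (from-V y)
      where
      to-V : ∀ x → Reach (ext G v e) x V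
      to-V zero = step here (isV-self v)
      to-V (suc zero) = step here (isV-self v)
      to-V (suc (suc zero)) = step here (isV-self v)
      to-V (suc (suc (suc i))) = lift (connected i v)
      from-V : ∀ y → Reach (ext G v e) V y
      from-V zero = step here (isV-self v)
      from-V (suc zero) = step here (isV-self v)
      from-V (suc (suc zero)) = step here (isV-self v)
      from-V (suc (suc (suc i))) = lift (connected v i)

    toℚ-twiceEdges : toℚ (twiceEdges (ext G v e)) ≡
      toℚ (deg (ext G v e) a) + (toℚ (deg (ext G v e) b) + (toℚ (deg (ext G v e) c) + (E + toℚ 3)))
    toℚ-twiceEdges = trans (toℚ-sumℕ (deg (ext G v e)))
      (cong (λ t → toℚ (deg (ext G v e) a) + (toℚ (deg (ext G v e) b) + (toℚ (deg (ext G v e) c) + t))) ∑-deg-old)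

  ∑-attached : ∀ (F : Fin (3 ℕ.+ n) → ℚ) → ∑[ k < n ] (if isV v k then F (old k) else 0ℚ) ≡ F V
  ∑-attached F = ∑-indicator v (F ∘ old)

  only-attached : ∀ F → 0ℚ + (0ℚ + (0ℚ + ∑[ k < n ] (if isV v k then F (old k) else 0ℚ))) ≡ F V
  only-attached F = trans (ℚP.+-identityˡ _) (trans (ℚP.+-identityˡ _) (trans (ℚP.+-identityˡ _) (∑-attached F)))

  adjSum-Gbar-new : ∀ x F → adjSum Ḡ (new x) F ≡ F V
  adjSum-Gbar-new zero = only-attached
  adjSum-Gbar-new (suc zero) = only-attached
  adjSum-Gbar-new (suc (suc zero)) = only-attached

  laplacian-Gbar-new : ∀ x F → laplacian Ḡ F (new x) ≡ F (new x) - F V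
  laplacian-Gbar-new x F = adjSum-Gbar-new x (λ k → F (new x) - F k)

  toℚ-deg-Gbar-new : ∀ x → toℚ (deg Ḡ (new x)) ≡ 1ℚ
  toℚ-deg-Gbar-new x = trans (toℚ-deg Ḡ (new x)) (adjSum-Gbar-new x (λ _ → 1ℚ))

  adjSum-Ghat-a : ∀ F → adjSum Ĝ a F ≡ F b + F V
  adjSum-Ghat-a F = trans (ℚP.+-identityˡ _) (cong (F b +_) (trans (ℚP.+-identityˡ _) (∑-attached F)))

  adjSum-Ghat-b : ∀ F → adjSum Ĝ b F ≡ F a + (F c + F V)
  adjSum-Ghat-b F = cong (F a +_) (trans (ℚP.+-identityˡ _) (cong (F c +_) (∑-attached F)))

  adjSum-Ghat-c : ∀ F → adjSum Ĝ c F ≡ F b + F V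
  adjSum-Ghat-c F = trans (ℚP.+-identityˡ _) (cong (F b +_) (trans (ℚP.+-identityˡ _) (∑-attached F)))

  twiceEdges-Gbar : toℚ (twiceEdges Ḡ) ≡ E + toℚ 6
  twiceEdges-Gbar = begin
    toℚ (twiceEdges Ḡ)              ≡⟨ toℚ-twiceEdges false ⟩
    toℚ (deg Ḡ a) + (toℚ (deg Ḡ b) + (toℚ (deg Ḡ c) + (E + toℚ 3)))
      ≡⟨ cong₂ (λ p q → p + (q + (toℚ (deg Ḡ c) + (E + toℚ 3)))) (toℚ-deg-Gbar-new zero) (toℚ-deg-Gbar-new (suc zero)) ⟩
    1ℚ + (1ℚ + (toℚ (deg Ḡ c) + (E + toℚ 3)))
      ≡⟨ cong (λ r → 1ℚ + (1ℚ + (r + (E + toℚ 3)))) (toℚ-deg-Gbar-new (suc (suc zero))) ⟩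
    1ℚ + (1ℚ + (1ℚ + (E + toℚ 3)))  ≡⟨ collect E ⟩
    E + toℚ 6                       ∎
    where
    open ≡-Reasoning
    collect : ∀ m → 1ℚ + (1ℚ + (1ℚ + (m + toℚ 3))) ≡ m + toℚ 6
    collect = solve 1 (λ m → con 1ℚ :+ (con 1ℚ :+ (con 1ℚ :+ (m :+ con (toℚ 3)))) := m :+ con (toℚ 6)) refl

  laplacian-Ghat-a : ∀ F → laplacian Ĝ F a ≡ (F a - F b) + (F a - F V)
  laplacian-Ghat-a F = adjSum-Ghat-a (λ k → F a - F k)

  laplacian-Ghat-b : ∀ F → laplacian Ĝ F b ≡ (F b - F a) + ((F b - F c) + (F b - F V))
  laplacian-Ghat-b F = adjSum-Ghat-b (λ k → F b - F k)

  laplacian-Ghat-c : ∀ F → laplacian Ĝ F c ≡ (F c - F b) + (F c - F V)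
  laplacian-Ghat-c F = adjSum-Ghat-c (λ k → F c - F k)

  toℚ-deg-Ghat-a : toℚ (deg Ĝ a) ≡ toℚ 2
  toℚ-deg-Ghat-a = trans (toℚ-deg Ĝ a) (adjSum-Ghat-a (λ _ → 1ℚ))

  toℚ-deg-Ghat-b : toℚ (deg Ĝ b) ≡ toℚ 3
  toℚ-deg-Ghat-b = trans (toℚ-deg Ĝ b) (adjSum-Ghat-b (λ _ → 1ℚ))

  toℚ-deg-Ghat-c : toℚ (deg Ĝ c) ≡ toℚ 2
  toℚ-deg-Ghat-c = trans (toℚ-deg Ĝ c) (adjSum-Ghat-c (λ _ → 1ℚ))

  twiceEdges-Ghat : toℚ (twiceEdges Ĝ) ≡ E + toℚ 10
  twiceEdges-Ghat = begin
    toℚ (twiceEdges Ĝ)                       ≡⟨ toℚ-twiceEdges true ⟩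
    toℚ (deg Ĝ a) + (toℚ (deg Ĝ b) + (toℚ (deg Ĝ c) + (E + toℚ 3)))
      ≡⟨ cong₂ (λ p q → p + (q + (toℚ (deg Ĝ c) + (E + toℚ 3)))) toℚ-deg-Ghat-a toℚ-deg-Ghat-b ⟩
    toℚ 2 + (toℚ 3 + (toℚ (deg Ĝ c) + (E + toℚ 3)))
      ≡⟨ cong (λ r → toℚ 2 + (toℚ 3 + (r + (E + toℚ 3)))) toℚ-deg-Ghat-c ⟩
    toℚ 2 + (toℚ 3 + (toℚ 2 + (E + toℚ 3)))  ≡⟨ collect E ⟩
    E + toℚ 10                               ∎
    where
    open ≡-Reasoning
    collect : ∀ m → toℚ 2 + (toℚ 3 + (toℚ 2 + (m + toℚ 3))) ≡ m + toℚ 10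
    collect = solve 1 (λ m →
      con (toℚ 2) :+ (con (toℚ 3) :+ (con (toℚ 2) :+ (m :+ con (toℚ 3)))) := m :+ con (toℚ 10)) refl

  -- Candidates for the columns of hitting times of Ĝ. Among the vertices of G only V has
  -- neighbours in {a, b, c}, so only its equation sees the offsets p, q, r.
  extend : (Fin (3 ℕ.+ n) → ℚ) → ℚ → ℚ → ℚ → Fin (3 ℕ.+ n) → ℚ
  extend Θ p q r zero = Θ V + p
  extend Θ p q r (suc zero) = Θ V + q
  extend Θ p q r (suc (suc zero)) = Θ V + r
  extend Θ p q r (suc (suc (suc i))) = Θ (old i)

  module _ (Θ : Fin (3 ℕ.+ n) → ℚ) (p q r : ℚ) where

    extend-equation-a : ∀ {s} → (p - q) + p ≡ s * toℚ 2 → laplacian Ĝ (extend Θ p q r) a ≡ s * toℚ (deg Ĝ a)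
    extend-equation-a {s} blob = begin
      laplacian Ĝ (extend Θ p q r) a               ≡⟨ laplacian-Ghat-a (extend Θ p q r) ⟩
      ((Θ V + p) - (Θ V + q)) + ((Θ V + p) - Θ V)  ≡⟨ offsets (Θ V) p q ⟩
      (p - q) + p                                  ≡⟨ blob ⟩
      s * toℚ 2                                    ≡⟨ cong (s *_) toℚ-deg-Ghat-a ⟨
      s * toℚ (deg Ĝ a)                            ∎
      where
      open ≡-Reasoning
      offsets : ∀ θ p q → ((θ + p) - (θ + q)) + ((θ + p) - θ) ≡ (p - q) + p
      offsets = solve 3 (λ θ p q → ((θ :+ p) :- (θ :+ q)) :+ ((θ :+ p) :- θ) := (p :- q) :+ p) refl

    extend-equation-b : ∀ {s} → (q - p) + ((q - r) + q) ≡ s * toℚ 3 →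
                        laplacian Ĝ (extend Θ p q r) b ≡ s * toℚ (deg Ĝ b)
    extend-equation-b {s} blob = begin
      laplacian Ĝ (extend Θ p q r) b                                           ≡⟨ laplacian-Ghat-b (extend Θ p q r) ⟩
      ((Θ V + q) - (Θ V + p)) + (((Θ V + q) - (Θ V + r)) + ((Θ V + q) - Θ V))  ≡⟨ offsets (Θ V) p q r ⟩
      (q - p) + ((q - r) + q)                                                  ≡⟨ blob ⟩
      s * toℚ 3                                                                ≡⟨ cong (s *_) toℚ-deg-Ghat-b ⟨
      s * toℚ (deg Ĝ b)                                                        ∎
      where
      open ≡-Reasoning
      offsets : ∀ θ p q r → ((θ + q) - (θ + p)) + (((θ + q) - (θ + r)) + ((θ + q) - θ)) ≡
                            (q - p) + ((q - r) + q)
      offsets = solve 4 (λ θ p q r →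
        ((θ :+ q) :- (θ :+ p)) :+ (((θ :+ q) :- (θ :+ r)) :+ ((θ :+ q) :- θ)) := (q :- p) :+ ((q :- r) :+ q)) refl

    extend-equation-c : ∀ {s} → (r - q) + r ≡ s * toℚ 2 → laplacian Ĝ (extend Θ p q r) c ≡ s * toℚ (deg Ĝ c)
    extend-equation-c {s} blob = begin
      laplacian Ĝ (extend Θ p q r) c               ≡⟨ laplacian-Ghat-c (extend Θ p q r) ⟩
      ((Θ V + r) - (Θ V + q)) + ((Θ V + r) - Θ V)  ≡⟨ offsets (Θ V) q r ⟩
      (r - q) + r                                  ≡⟨ blob ⟩
      s * toℚ 2                                    ≡⟨ cong (s *_) toℚ-deg-Ghat-c ⟨
      s * toℚ (deg Ĝ c)                            ∎
      where
      open ≡-Reasoning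
      offsets : ∀ θ q r → ((θ + r) - (θ + q)) + ((θ + r) - θ) ≡ (r - q) + r
      offsets = solve 3 (λ θ q r → ((θ :+ r) :- (θ :+ q)) :+ ((θ :+ r) :- θ) := (r :- q) :+ r) refl

    laplacian-extend-old : ∀ {i} → i ≢ v → laplacian Ĝ (extend Θ p q r) (old i) ≡ laplacian Ḡ Θ (old i)
    laplacian-extend-old i≢v = trans (laplacian-old true i≢v (extend Θ p q r)) (sym (laplacian-old false i≢v Θ))

    laplacian-extend-V : ∀ {t} → (∀ x → Θ (new x) ≡ Θ V + t) →
                         laplacian Ĝ (extend Θ p q r) V ≡ laplacian Ḡ Θ V + (toℚ 3 * t - (p + q + r))
    laplacian-extend-V {t} offsets = begin
      laplacian Ĝ (extend Θ p q r) V                         ≡⟨ laplacian-V true (extend Θ p q r) ⟩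
      (θ - (θ + p)) + ((θ - (θ + q)) + ((θ - (θ + r)) + ℓ))  ≡⟨ regroup θ t p q r ℓ ⟩
      (θ - (θ + t)) + ((θ - (θ + t)) + ((θ - (θ + t)) + ℓ)) + (toℚ 3 * t - (p + q + r))
        ≡⟨ cong (_+ (toℚ 3 * t - (p + q + r))) Gbar-at-V ⟨
      laplacian Ḡ Θ V + (toℚ 3 * t - (p + q + r))            ∎
      where
      open ≡-Reasoning
      θ ℓ : ℚ
      θ = Θ V
      ℓ = laplacian G (Θ ∘ old) v
      Gbar-at-V : laplacian Ḡ Θ V ≡ (θ - (θ + t)) + ((θ - (θ + t)) + ((θ - (θ + t)) + ℓ))
      Gbar-at-V = trans (laplacian-V false Θ) substitute
        where
        substitute : (θ - Θ a) + ((θ - Θ b) + ((θ - Θ c) + ℓ)) ≡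
                     (θ - (θ + t)) + ((θ - (θ + t)) + ((θ - (θ + t)) + ℓ))
        substitute rewrite offsets zero | offsets (suc zero) | offsets (suc (suc zero)) = refl
      regroup : ∀ θ t p q r ℓ → (θ - (θ + p)) + ((θ - (θ + q)) + ((θ - (θ + r)) + ℓ)) ≡
                               (θ - (θ + t)) + ((θ - (θ + t)) + ((θ - (θ + t)) + ℓ)) + (toℚ 3 * t - (p + q + r))
      regroup = solve 6 (λ θ t p q r ℓ →
        (θ :- (θ :+ p)) :+ ((θ :- (θ :+ q)) :+ ((θ :- (θ :+ r)) :+ ℓ))
        := (θ :- (θ :+ t)) :+ ((θ :- (θ :+ t)) :+ ((θ :- (θ :+ t)) :+ ℓ)) :+ (con (toℚ 3) :* t :- (p :+ q :+ r))) refl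

    extend-equations-old : ∀ {t s σ τ} → (∀ x → Θ (new x) ≡ Θ V + t) →
      (∀ {i} → i ≢ v → old i ≢ τ → laplacian Ḡ Θ (old i) ≡ s * toℚ (deg Ḡ (old i))) →
      (V ≢ τ → laplacian Ḡ Θ V ≡ s * toℚ (deg Ḡ V) - σ) →
      p + q + r ≡ toℚ 3 * t - σ →
      ∀ i → old i ≢ τ → laplacian Ĝ (extend Θ p q r) (old i) ≡ s * toℚ (deg Ĝ (old i))
    extend-equations-old {t} {s} {σ} {τ} offsets at-old at-V p+q+r i old-i≢τ = by-cases (i Fin.≟ v) old-i≢τ
      where
      open ≡-Reasoning
      Φ : Fin (3 ℕ.+ n) → ℚ
      Φ = extend Θ p q r
      at-V-extended : V ≢ τ → laplacian Ĝ Φ V ≡ s * toℚ (deg Ĝ V)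
      at-V-extended V≢τ = begin
        laplacian Ĝ Φ V                                        ≡⟨ laplacian-extend-V offsets ⟩
        laplacian Ḡ Θ V + (toℚ 3 * t - (p + q + r))            ≡⟨ cong₂ (λ l u → l + (toℚ 3 * t - u)) (at-V V≢τ) p+q+r ⟩
        s * toℚ (deg Ḡ V) - σ + (toℚ 3 * t - (toℚ 3 * t - σ))  ≡⟨ cancel (s * toℚ (deg Ḡ V)) σ (toℚ 3 * t) ⟩
        s * toℚ (deg Ĝ V)                                      ∎
        where
        cancel : ∀ x σ u → x - σ + (u - (u - σ)) ≡ x
        cancel = solve 3 (λ x σ u → x :- σ :+ (u :- (u :- σ)) := x) refl
      by-cases : Dec (i ≡ v) → old i ≢ τ → laplacian Ĝ Φ (old i) ≡ s * toℚ (deg Ĝ (old i))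
      by-cases (no i≢v) old-i≢τ = trans (laplacian-extend-old i≢v) (at-old i≢v old-i≢τ)
      by-cases (yes i≡v) =
        subst (λ k → old k ≢ τ → laplacian Ĝ Φ (old k) ≡ s * toℚ (deg Ĝ (old k))) (sym i≡v) at-V-extended

  module _ {M̄ : Fin (3 ℕ.+ n) → Fin (3 ℕ.+ n) → ℚ} (hitting-Ḡ : IsHittingTimes Ḡ M̄) where

    pendant-hitting : ∀ x {j} → new x ≢ j → M̄ (new x) j ≡ 1ℚ + M̄ V j
    pendant-hitting x {j} x≢j = begin
      M̄ (new x) j                      ≡⟨ shift (M̄ (new x) j) (M̄ V j) ⟩
      (M̄ (new x) j - M̄ V j) + M̄ V j  ≡⟨ cong (_+ M̄ V j) step-to-V ⟩
      1ℚ + M̄ V j                       ∎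
      where
      open ≡-Reasoning
      step-to-V : M̄ (new x) j - M̄ V j ≡ 1ℚ
      step-to-V = begin
        M̄ (new x) j - M̄ V j               ≡⟨ laplacian-Gbar-new x (λ y → M̄ y j) ⟨
        laplacian Ḡ (λ y → M̄ y j) (new x)  ≡⟨ hitting-equations Ḡ hitting-Ḡ j (new x) x≢j ⟩
        1ℚ * toℚ (deg Ḡ (new x))            ≡⟨ cong (1ℚ *_) (toℚ-deg-Gbar-new x) ⟩
        1ℚ                                  ∎
      shift : ∀ m w → m ≡ (m - w) + w
      shift = solve 2 (λ m w → m := (m :- w) :+ w) refl

    laplacian-Gbar-at-V : laplacian Ḡ (λ y → M̄ y V) V ≡ toℚ (deg Ḡ V) - (E + toℚ 6)
    laplacian-Gbar-at-V =
      trans (laplacian-at-target Ḡ hitting-Ḡ V) (cong (λ m → toℚ (deg Ḡ V) - m) twiceEdges-Gbar)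

    hitting-between-new : ∀ {x y} → new x ≢ new y → M̄ (new x) (new y) ≡ E + toℚ 6
    hitting-between-new {x} {y} x≢y = begin
      M̄ (new x) (new y)              ≡⟨ pendant-hitting x x≢y ⟩
      1ℚ + M̄ V (new y)               ≡⟨ expand (M̄ V (new y)) (M̄ (new y) (new y)) ⟩
      1ℚ + (M̄ (new y) (new y) - (M̄ (new y) (new y) - M̄ V (new y)))
        ≡⟨ cong₂ (λ m l → 1ℚ + (m - l)) (proj₁ hitting-Ḡ (new y)) return ⟩
      1ℚ + (0ℚ - (1ℚ - (E + toℚ 6)))  ≡⟨ collect E ⟩
      E + toℚ 6                       ∎
      where
      open ≡-Reasoning
      return : M̄ (new y) (new y) - M̄ V (new y) ≡ 1ℚ - (E + toℚ 6)
      return = begin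
        M̄ (new y) (new y) - M̄ V (new y)         ≡⟨ laplacian-Gbar-new y (λ z → M̄ z (new y)) ⟨
        laplacian Ḡ (λ z → M̄ z (new y)) (new y)  ≡⟨ laplacian-at-target Ḡ hitting-Ḡ (new y) ⟩
        toℚ (deg Ḡ (new y)) - toℚ (twiceEdges Ḡ)  ≡⟨ cong₂ _-_ (toℚ-deg-Gbar-new y) twiceEdges-Gbar ⟩
        1ℚ - (E + toℚ 6)                          ∎
      expand : ∀ w m → 1ℚ + w ≡ 1ℚ + (m - (m - w))
      expand = solve 2 (λ w m → con 1ℚ :+ w := con 1ℚ :+ (m :- (m :- w))) refl
      collect : ∀ m → 1ℚ + (0ℚ - (1ℚ - (m + toℚ 6))) ≡ m + toℚ 6
      collect = solve 1 (λ m → con 1ℚ :+ (con 0ℚ :- (con 1ℚ :- (m :+ con (toℚ 6)))) := m :+ con (toℚ 6)) refl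

    potentialV : ℚ → ℚ → Fin (3 ℕ.+ n) → ℚ
    potentialV β γ y = β * M̄ y V + γ

    potentialV-new : ∀ β γ x → potentialV β γ (new x) ≡ potentialV β γ V + β
    potentialV-new β γ x = begin
      β * M̄ (new x) V + γ   ≡⟨ cong (λ m → β * m + γ) (pendant-hitting x (new≢old x)) ⟩
      β * (1ℚ + M̄ V V) + γ  ≡⟨ distribute β (M̄ V V) γ ⟩
      β * M̄ V V + γ + β     ∎
      where
      open ≡-Reasoning
      distribute : ∀ β m γ → β * (1ℚ + m) + γ ≡ β * m + γ + β
      distribute = solve 3 (λ β m γ → β :* (con 1ℚ :+ m) :+ γ := β :* m :+ γ :+ β) refl

    potentialV-old : ∀ β γ {i} → i ≢ v → laplacian Ḡ (potentialV β γ) (old i) ≡ β * toℚ (deg Ḡ (old i))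
    potentialV-old β γ {i} i≢v = begin
      laplacian Ḡ (potentialV β γ) (old i)    ≡⟨ laplacian-affine Ḡ β (λ y → M̄ y V) γ (old i) ⟩
      β * laplacian Ḡ (λ y → M̄ y V) (old i)  ≡⟨ cong (β *_) (hitting-equations Ḡ hitting-Ḡ V (old i) (i≢v ∘ old-injective)) ⟩
      β * (1ℚ * toℚ (deg Ḡ (old i)))          ≡⟨ cong (β *_) (ℚP.*-identityˡ _) ⟩
      β * toℚ (deg Ḡ (old i))                 ∎
      where open ≡-Reasoning

    potentialV-at-V : ∀ β γ → laplacian Ḡ (potentialV β γ) V ≡ β * toℚ (deg Ḡ V) - β * (E + toℚ 6)
    potentialV-at-V β γ = begin
      laplacian Ḡ (potentialV β γ) V       ≡⟨ laplacian-affine Ḡ β (λ y → M̄ y V) γ V ⟩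
      β * laplacian Ḡ (λ y → M̄ y V) V     ≡⟨ cong (β *_) laplacian-Gbar-at-V ⟩
      β * (toℚ (deg Ḡ V) - (E + toℚ 6))    ≡⟨ distribute β (toℚ (deg Ḡ V)) (E + toℚ 6) ⟩
      β * toℚ (deg Ḡ V) - β * (E + toℚ 6)  ∎
      where
      open ≡-Reasoning
      distribute : ∀ β d m → β * (d - m) ≡ β * d - β * m
      distribute = solve 3 (λ β d m → β :* (d :- m) := β :* d :- β :* m) refl

    potential : Fin (3 ℕ.+ n) → ℚ → ℚ → ℚ → Fin (3 ℕ.+ n) → ℚ
    potential J α β γ y = α * M̄ y J + potentialV β γ y

    potential-new : ∀ j α β γ x → potential (old j) α β γ (new x) ≡ potential (old j) α β γ V + (α + β)
    potential-new j α β γ x = begin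
      α * M̄ (new x) (old j) + potentialV β γ (new x)
        ≡⟨ cong₂ (λ m w → α * m + w) (pendant-hitting x (new≢old x)) (potentialV-new β γ x) ⟩
      α * (1ℚ + M̄ V (old j)) + (potentialV β γ V + β)  ≡⟨ distribute α (M̄ V (old j)) (potentialV β γ V) β ⟩
      α * M̄ V (old j) + potentialV β γ V + (α + β)     ∎
      where
      open ≡-Reasoning
      distribute : ∀ α m w β → α * (1ℚ + m) + (w + β) ≡ α * m + w + (α + β)
      distribute = solve 4 (λ α m w β → α :* (con 1ℚ :+ m) :+ (w :+ β) := α :* m :+ w :+ (α :+ β)) refl

    laplacian-potential : ∀ J α β γ x →
      laplacian Ḡ (potential J α β γ) x ≡ α * laplacian Ḡ (λ y → M̄ y J) x + laplacian Ḡ (potentialV β γ) x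
    laplacian-potential J α β γ x = trans (laplacian-+ Ḡ (λ y → α * M̄ y J) (potentialV β γ) x)
                                          (cong (_+ _) (laplacian-* Ḡ α (λ y → M̄ y J) x))

    potential-old : ∀ J α β γ {i} → i ≢ v → old i ≢ J →
      laplacian Ḡ (potential J α β γ) (old i) ≡ (α + β) * toℚ (deg Ḡ (old i))
    potential-old J α β γ {i} i≢v old-i≢J = begin
      laplacian Ḡ (potential J α β γ) (old i)  ≡⟨ laplacian-potential J α β γ (old i) ⟩
      α * laplacian Ḡ (λ y → M̄ y J) (old i) + laplacian Ḡ (potentialV β γ) (old i)
        ≡⟨ cong₂ (λ l w → α * l + w) (hitting-equations Ḡ hitting-Ḡ J (old i) old-i≢J) (potentialV-old β γ i≢v) ⟩
      α * (1ℚ * d) + β * d                     ≡⟨ collect α β d ⟩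
      (α + β) * d                              ∎
      where
      open ≡-Reasoning
      d : ℚ
      d = toℚ (deg Ḡ (old i))
      collect : ∀ α β d → α * (1ℚ * d) + β * d ≡ (α + β) * d
      collect = solve 3 (λ α β d → α :* (con 1ℚ :* d) :+ β :* d := (α :+ β) :* d) refl

    potential-at-V : ∀ J α β γ → V ≢ J →
                     laplacian Ḡ (potential J α β γ) V ≡ (α + β) * toℚ (deg Ḡ V) - β * (E + toℚ 6)
    potential-at-V J α β γ V≢J = begin
      laplacian Ḡ (potential J α β γ) V         ≡⟨ laplacian-potential J α β γ V ⟩
      α * laplacian Ḡ (λ y → M̄ y J) V + laplacian Ḡ (potentialV β γ) V
        ≡⟨ cong₂ (λ l w → α * l + w) (hitting-equations Ḡ hitting-Ḡ J V V≢J) (potentialV-at-V β γ) ⟩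
      α * (1ℚ * d) + (β * d - β * (E + toℚ 6))  ≡⟨ collect α β d (E + toℚ 6) ⟩
      (α + β) * d - β * (E + toℚ 6)             ∎
      where
      open ≡-Reasoning
      d : ℚ
      d = toℚ (deg Ḡ V)
      collect : ∀ α β d m → α * (1ℚ * d) + (β * d - β * m) ≡ (α + β) * d - β * m
      collect = solve 4 (λ α β d m → α :* (con 1ℚ :* d) :+ (β :* d :- β :* m) := (α :+ β) :* d :- β :* m) refl

    δ : Fin n → ℚ
    δ i = toℚ (deg Ĝ (old i))

    A B : ℚ
    A = ∑[ i < n ] (δ i * M̄ V (old i))
    B = ∑[ i < n ] (δ i * M̄ (old i) V)

    kemeny-Gbar : ∀ {κ̄} → sumℚ (λ j → toℚ (deg Ḡ j) * M̄ a j) ≡ toℚ (twiceEdges Ḡ) * κ̄ →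
                  (E + toℚ 6) * κ̄ ≡ toℚ 3 * E + toℚ 15 + A
    kemeny-Gbar {κ̄} row = begin
      (E + toℚ 6) * κ̄                                                     ≡⟨ cong (_* κ̄) twiceEdges-Gbar ⟨
      toℚ (twiceEdges Ḡ) * κ̄                                              ≡⟨ row ⟨
      toℚ (deg Ḡ a) * M̄ a a + (toℚ (deg Ḡ b) * M̄ a b + (toℚ (deg Ḡ c) * M̄ a c + sumℚ (λ i → δ i * M̄ a (old i))))
        ≡⟨ cong₂ _+_ (cong₂ _*_ (toℚ-deg-Gbar-new zero) (proj₁ hitting-Ḡ a))
             (cong₂ _+_ (cong₂ _*_ (toℚ-deg-Gbar-new (suc zero)) (hitting-between-new (λ ())))
               (cong₂ _+_ (cong₂ _*_ (toℚ-deg-Gbar-new (suc (suc zero))) (hitting-between-new (λ ()))) tail)) ⟩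
      1ℚ * 0ℚ + (1ℚ * (E + toℚ 6) + (1ℚ * (E + toℚ 6) + (E + toℚ 3 + A)))  ≡⟨ collect E A ⟩
      toℚ 3 * E + toℚ 15 + A                                               ∎
      where
      open ≡-Reasoning
      collect : ∀ E A → 1ℚ * 0ℚ + (1ℚ * (E + toℚ 6) + (1ℚ * (E + toℚ 6) + (E + toℚ 3 + A))) ≡ toℚ 3 * E + toℚ 15 + A
      collect = solve 2 (λ E A →
        con 1ℚ :* con 0ℚ :+ (con 1ℚ :* (E :+ con (toℚ 6)) :+ (con 1ℚ :* (E :+ con (toℚ 6)) :+ (E :+ con (toℚ 3) :+ A)))
        := con (toℚ 3) :* E :+ con (toℚ 15) :+ A) refl
      tail : sumℚ (λ i → δ i * M̄ a (old i)) ≡ E + toℚ 3 + A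
      tail = begin
        sumℚ (λ i → δ i * M̄ a (old i))             ≡⟨ sumℚ≡∑ (λ i → δ i * M̄ a (old i)) ⟩
        ∑[ i < n ] (δ i * M̄ a (old i))             ≡⟨ sum-cong-≗ (λ i → cong (δ i *_) (pendant-hitting zero (new≢old zero))) ⟩
        ∑[ i < n ] (δ i * (1ℚ + M̄ V (old i)))      ≡⟨ sum-cong-≗ (λ i → ℚP.*-distribˡ-+ (δ i) 1ℚ (M̄ V (old i))) ⟩
        ∑[ i < n ] (δ i * 1ℚ + δ i * M̄ V (old i))  ≡⟨ ∑-distrib-+ (λ i → δ i * 1ℚ) (λ i → δ i * M̄ V (old i)) ⟩
        ∑[ i < n ] (δ i * 1ℚ) + A
          ≡⟨ cong (_+ A) (trans (sum-cong-≗ (λ i → ℚP.*-identityʳ (δ i))) (∑-deg-old true)) ⟩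
        E + toℚ 3 + A                               ∎

    one≤B : Connected Ḡ → HasEdge G → 1ℚ ≤ B
    one≤B connected (p , q , p~q) = by-cases (p Fin.≟ v)
      where
      at-vertex : ∀ {w u} → w ≢ v → Adj G w u ≡ true → 1ℚ ≤ B
      at-vertex {w} {u} w≢v w~u = ℚP.≤-trans (degree-positive Ḡ {old w} {old u} w~u)
        (ℚP.≤-trans (degree≤degree*hitting Ḡ hitting-Ḡ connected (w≢v ∘ old-injective))
          (term≤∑ (λ i → *-nonneg (degree-nonneg Ĝ (old i)) (hitting-nonneg Ḡ hitting-Ḡ connected (old i) V)) w))
      by-cases : Dec (p ≡ v) → 1ℚ ≤ B
      by-cases (no p≢v) = at-vertex p≢v p~q
      by-cases (yes p≡v) = at-vertex q≢v (trans (SimpleGraph.sym G q p) p~q)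
        where
        q≢v : q ≢ v
        q≢v q≡v with trans (sym (loopless G p)) (subst (λ u → Adj G p u ≡ true) (trans q≡v (sym p≡v)) p~q)
        ... | ()

    kemeny-gap-positive : toℚ 2 ≤ E → 1ℚ ≤ B → 0ℚ < (E - toℚ 2) * (toℚ 4 * E + toℚ 18) + toℚ 16 * B
    kemeny-gap-positive 2≤E 1≤B = ℚP.+-mono-≤-< (*-nonneg (p≤q⇒0≤q-p 2≤E) 0≤4E+18)
      (ℚP.<-≤-trans (ℚP.positive⁻¹ (toℚ 16)) (ℚP.*-monoˡ-≤-nonNeg (toℚ 16) 1≤B))
      where
      0≤4E+18 : 0ℚ ≤ toℚ 4 * E + toℚ 18
      0≤4E+18 = ℚP.+-mono-≤ (*-nonneg (ℚP.nonNegative⁻¹ (toℚ 4)) (ℚP.≤-trans (ℚP.nonNegative⁻¹ (toℚ 2)) 2≤E))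
                            (ℚP.nonNegative⁻¹ (toℚ 18))

    module _ {M̂ : Fin (3 ℕ.+ n) → Fin (3 ℕ.+ n) → ℚ} (hitting-Ĝ : IsHittingTimes Ĝ M̂)
             (connected-Ĝ : Connected Ĝ) where

      hitting-Ghat-a-b : toℚ 4 * M̂ a b ≡ E + toℚ 9
      hitting-Ghat-a-b = begin
        toℚ 4 * M̂ a b      ≡⟨ hitting-unique Ĝ hitting-Ĝ connected-Ĝ {s = toℚ 4} {Φ = Φ} equations Φb≡0 a ⟨
        Φ a                 ≡⟨ cong (λ m → toℚ 4 * m + γ + p) (proj₁ hitting-Ḡ V) ⟩
        toℚ 4 * 0ℚ + γ + p  ≡⟨ value E ⟩
        E + toℚ 9           ∎
        where
        open ≡-Reasoning
        γ p q r : ℚ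
        γ = toℚ 2 * E + toℚ 10
        p = - E - toℚ 1
        q = - (toℚ 2 * E + toℚ 10)
        r = - E - toℚ 1
        Θ Φ : Fin (3 ℕ.+ n) → ℚ
        Θ = potentialV (toℚ 4) γ
        Φ = extend Θ p q r
        blob-ac : ∀ E → ((- E - toℚ 1) - (- (toℚ 2 * E + toℚ 10))) + (- E - toℚ 1) ≡ toℚ 4 * toℚ 2
        blob-ac = solve 1 (λ E →
          ((:- E :- con (toℚ 1)) :- (:- (con (toℚ 2) :* E :+ con (toℚ 10)))) :+ (:- E :- con (toℚ 1))
          := con (toℚ 4) :* con (toℚ 2)) refl
        equations : HittingEquations Ĝ b (toℚ 4) Φ
        equations zero _ = extend-equation-a Θ p q r (blob-ac E)
        equations (suc zero) b≢b = ⊥-elim (b≢b refl)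
        equations (suc (suc zero)) _ = extend-equation-c Θ p q r (blob-ac E)
        equations (suc (suc (suc i))) =
          extend-equations-old Θ p q r {t = toℚ 4} {s = toℚ 4} {σ = toℚ 4 * (E + toℚ 6)} (potentialV-new (toℚ 4) γ)
          (λ i≢v _ → potentialV-old (toℚ 4) γ i≢v) (λ _ → potentialV-at-V (toℚ 4) γ) (p+q+r E) i
          where
          p+q+r : ∀ E → (- E - toℚ 1) + (- (toℚ 2 * E + toℚ 10)) + (- E - toℚ 1) ≡
                        toℚ 3 * toℚ 4 - toℚ 4 * (E + toℚ 6)
          p+q+r = solve 1 (λ E →
            (:- E :- con (toℚ 1)) :+ (:- (con (toℚ 2) :* E :+ con (toℚ 10))) :+ (:- E :- con (toℚ 1))
            := con (toℚ 3) :* con (toℚ 4) :- con (toℚ 4) :* (E :+ con (toℚ 6))) refl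
        Φb≡0 : Φ b ≡ 0ℚ
        Φb≡0 = trans (cong (λ m → toℚ 4 * m + γ + q) (proj₁ hitting-Ḡ V)) (zero-at-b E)
          where
          zero-at-b : ∀ E → toℚ 4 * 0ℚ + (toℚ 2 * E + toℚ 10) + - (toℚ 2 * E + toℚ 10) ≡ 0ℚ
          zero-at-b = solve 1 (λ E →
            con (toℚ 4) :* con 0ℚ :+ (con (toℚ 2) :* E :+ con (toℚ 10)) :+ :- (con (toℚ 2) :* E :+ con (toℚ 10))
            := con 0ℚ) refl
        value : ∀ E → toℚ 4 * 0ℚ + (toℚ 2 * E + toℚ 10) + (- E - toℚ 1) ≡ E + toℚ 9
        value = solve 1 (λ E →
          con (toℚ 4) :* con 0ℚ :+ (con (toℚ 2) :* E :+ con (toℚ 10)) :+ (:- E :- con (toℚ 1))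
          := E :+ con (toℚ 9)) refl

      hitting-Ghat-a-c : toℚ 8 * M̂ a c ≡ toℚ 4 * E + toℚ 40
      hitting-Ghat-a-c = begin
        toℚ 8 * M̂ a c      ≡⟨ hitting-unique Ĝ hitting-Ĝ connected-Ĝ {s = toℚ 8} {Φ = Φ} equations Φc≡0 a ⟨
        Φ a                 ≡⟨ cong (λ m → toℚ 8 * m + γ + p) (proj₁ hitting-Ḡ V) ⟩
        toℚ 8 * 0ℚ + γ + p  ≡⟨ value E ⟩
        toℚ 4 * E + toℚ 40  ∎
        where
        open ≡-Reasoning
        γ p q r : ℚ
        γ = toℚ 5 * E + toℚ 32
        p = toℚ 8 - E
        q = - (toℚ 2 * E)
        r = - (toℚ 5 * E + toℚ 32)
        Θ Φ : Fin (3 ℕ.+ n) → ℚ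
        Θ = potentialV (toℚ 8) γ
        Φ = extend Θ p q r
        blob-a : ∀ E → ((toℚ 8 - E) - (- (toℚ 2 * E))) + (toℚ 8 - E) ≡ toℚ 8 * toℚ 2
        blob-a = solve 1 (λ E →
          ((con (toℚ 8) :- E) :- (:- (con (toℚ 2) :* E))) :+ (con (toℚ 8) :- E) := con (toℚ 8) :* con (toℚ 2)) refl
        blob-b : ∀ E → (- (toℚ 2 * E) - (toℚ 8 - E)) + ((- (toℚ 2 * E) - (- (toℚ 5 * E + toℚ 32))) + - (toℚ 2 * E)) ≡
                       toℚ 8 * toℚ 3
        blob-b = solve 1 (λ E →
          (:- (con (toℚ 2) :* E) :- (con (toℚ 8) :- E))
            :+ ((:- (con (toℚ 2) :* E) :- (:- (con (toℚ 5) :* E :+ con (toℚ 32)))) :+ :- (con (toℚ 2) :* E))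
          := con (toℚ 8) :* con (toℚ 3)) refl
        p+q+r : ∀ E → (toℚ 8 - E) + - (toℚ 2 * E) + - (toℚ 5 * E + toℚ 32) ≡
                      toℚ 3 * toℚ 8 - toℚ 8 * (E + toℚ 6)
        p+q+r = solve 1 (λ E →
          (con (toℚ 8) :- E) :+ :- (con (toℚ 2) :* E) :+ :- (con (toℚ 5) :* E :+ con (toℚ 32))
          := con (toℚ 3) :* con (toℚ 8) :- con (toℚ 8) :* (E :+ con (toℚ 6))) refl
        equations : HittingEquations Ĝ c (toℚ 8) Φ
        equations zero _ = extend-equation-a Θ p q r (blob-a E)
        equations (suc zero) _ = extend-equation-b Θ p q r (blob-b E)
        equations (suc (suc zero)) c≢c = ⊥-elim (c≢c refl)
        equations (suc (suc (suc i))) =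
          extend-equations-old Θ p q r {t = toℚ 8} {s = toℚ 8} {σ = toℚ 8 * (E + toℚ 6)} (potentialV-new (toℚ 8) γ)
          (λ i≢v _ → potentialV-old (toℚ 8) γ i≢v) (λ _ → potentialV-at-V (toℚ 8) γ) (p+q+r E) i
        Φc≡0 : Φ c ≡ 0ℚ
        Φc≡0 = trans (cong (λ m → toℚ 8 * m + γ + r) (proj₁ hitting-Ḡ V)) (zero-at-c E)
          where
          zero-at-c : ∀ E → toℚ 8 * 0ℚ + (toℚ 5 * E + toℚ 32) + - (toℚ 5 * E + toℚ 32) ≡ 0ℚ
          zero-at-c = solve 1 (λ E →
            con (toℚ 8) :* con 0ℚ :+ (con (toℚ 5) :* E :+ con (toℚ 32)) :+ :- (con (toℚ 5) :* E :+ con (toℚ 32))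
            := con 0ℚ) refl
        value : ∀ E → toℚ 8 * 0ℚ + (toℚ 5 * E + toℚ 32) + (toℚ 8 - E) ≡ toℚ 4 * E + toℚ 40
        value = solve 1 (λ E →
          con (toℚ 8) :* con 0ℚ :+ (con (toℚ 5) :* E :+ con (toℚ 32)) :+ (con (toℚ 8) :- E)
          := con (toℚ 4) :* E :+ con (toℚ 40)) refl

      -- For x, j in G the two extra edges only lengthen the excursions from V into {a, b, c}:
      -- (E + 6) M̂(x, j) = (E + 10) M̄(x, j) + 4 (M̄(j, V) - M̄(x, V)). On a, b, c one adds the
      -- hitting times of V in Ĝ, namely 9/4, 10/4 and 9/4. Everything is scaled by 4 (E + 6).
      hitting-Ghat-a-old : ∀ j → toℚ 4 * (E + toℚ 6) * M̂ a (old j) ≡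
                           toℚ 4 * (E + toℚ 10) * M̄ V (old j) + toℚ 16 * M̄ (old j) V + toℚ 9 * (E + toℚ 6)
      hitting-Ghat-a-old j = begin
        toℚ 4 * (E + toℚ 6) * M̂ a J                                           ≡⟨ cong (_* M̂ a J) (scale E) ⟩
        (α + β) * M̂ a J
          ≡⟨ hitting-unique Ĝ hitting-Ĝ connected-Ĝ {s = α + β} {Φ = Φ} equations ΦJ≡0 a ⟨
        Φ a
          ≡⟨ cong (λ m → α * M̄ V J + (β * m + γ) + p) (proj₁ hitting-Ḡ V) ⟩
        α * M̄ V J + (β * 0ℚ + γ) + p                                          ≡⟨ value E (M̄ V J) (M̄ J V) ⟩
        toℚ 4 * (E + toℚ 10) * M̄ V J + toℚ 16 * M̄ J V + toℚ 9 * (E + toℚ 6)  ∎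
        where
        open ≡-Reasoning
        J : Fin (3 ℕ.+ n)
        J = old j
        α β γ p q r : ℚ
        α = toℚ 4 * (E + toℚ 10)
        β = - toℚ 16
        γ = toℚ 16 * M̄ J V
        p = toℚ 9 * (E + toℚ 6)
        q = toℚ 10 * (E + toℚ 6)
        r = toℚ 9 * (E + toℚ 6)
        Θ Φ : Fin (3 ℕ.+ n) → ℚ
        Θ = potential J α β γ
        Φ = extend Θ p q r
        scale : ∀ E → toℚ 4 * (E + toℚ 6) ≡ toℚ 4 * (E + toℚ 10) + - toℚ 16
        scale = solve 1 (λ E →
          con (toℚ 4) :* (E :+ con (toℚ 6)) := con (toℚ 4) :* (E :+ con (toℚ 10)) :+ :- con (toℚ 16)) refl
        blob-ac : ∀ E → (toℚ 9 * (E + toℚ 6) - toℚ 10 * (E + toℚ 6)) + toℚ 9 * (E + toℚ 6) ≡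
                        (toℚ 4 * (E + toℚ 10) + - toℚ 16) * toℚ 2
        blob-ac = solve 1 (λ E →
          (con (toℚ 9) :* (E :+ con (toℚ 6)) :- con (toℚ 10) :* (E :+ con (toℚ 6))) :+ con (toℚ 9) :* (E :+ con (toℚ 6))
          := (con (toℚ 4) :* (E :+ con (toℚ 10)) :+ :- con (toℚ 16)) :* con (toℚ 2)) refl
        blob-b : ∀ E → (toℚ 10 * (E + toℚ 6) - toℚ 9 * (E + toℚ 6))
                         + ((toℚ 10 * (E + toℚ 6) - toℚ 9 * (E + toℚ 6)) + toℚ 10 * (E + toℚ 6)) ≡
                       (toℚ 4 * (E + toℚ 10) + - toℚ 16) * toℚ 3
        blob-b = solve 1 (λ E →
          (con (toℚ 10) :* (E :+ con (toℚ 6)) :- con (toℚ 9) :* (E :+ con (toℚ 6)))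
            :+ ((con (toℚ 10) :* (E :+ con (toℚ 6)) :- con (toℚ 9) :* (E :+ con (toℚ 6))) :+ con (toℚ 10) :* (E :+ con (toℚ 6)))
          := (con (toℚ 4) :* (E :+ con (toℚ 10)) :+ :- con (toℚ 16)) :* con (toℚ 3)) refl
        p+q+r : ∀ E → toℚ 9 * (E + toℚ 6) + toℚ 10 * (E + toℚ 6) + toℚ 9 * (E + toℚ 6) ≡
                      toℚ 3 * (toℚ 4 * (E + toℚ 10) + - toℚ 16) - - toℚ 16 * (E + toℚ 6)
        p+q+r = solve 1 (λ E →
          con (toℚ 9) :* (E :+ con (toℚ 6)) :+ con (toℚ 10) :* (E :+ con (toℚ 6)) :+ con (toℚ 9) :* (E :+ con (toℚ 6))
          := con (toℚ 3) :* (con (toℚ 4) :* (E :+ con (toℚ 10)) :+ :- con (toℚ 16)) :- :- con (toℚ 16) :* (E :+ con (toℚ 6))) refl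
        equations : HittingEquations Ĝ J (α + β) Φ
        equations zero _ = extend-equation-a Θ p q r {s = α + β} (blob-ac E)
        equations (suc zero) _ = extend-equation-b Θ p q r {s = α + β} (blob-b E)
        equations (suc (suc zero)) _ = extend-equation-c Θ p q r {s = α + β} (blob-ac E)
        equations (suc (suc (suc i))) = extend-equations-old Θ p q r {t = α + β} {s = α + β} {σ = β * (E + toℚ 6)}
          (potential-new j α β γ) (potential-old J α β γ) (potential-at-V J α β γ) (p+q+r E) i
        ΦJ≡0 : Φ J ≡ 0ℚ
        ΦJ≡0 = trans (cong (λ m → α * m + (β * M̄ J V + γ)) (proj₁ hitting-Ḡ J)) (cancel α (M̄ J V))
          where
          cancel : ∀ α m → α * 0ℚ + (- toℚ 16 * m + toℚ 16 * m) ≡ 0ℚ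
          cancel = solve 2 (λ α m → α :* con 0ℚ :+ (:- con (toℚ 16) :* m :+ con (toℚ 16) :* m) := con 0ℚ) refl
        value : ∀ E x y → toℚ 4 * (E + toℚ 10) * x + (- toℚ 16 * 0ℚ + toℚ 16 * y) + toℚ 9 * (E + toℚ 6) ≡
                          toℚ 4 * (E + toℚ 10) * x + toℚ 16 * y + toℚ 9 * (E + toℚ 6)
        value = solve 3 (λ E x y →
          con (toℚ 4) :* (E :+ con (toℚ 10)) :* x :+ (:- con (toℚ 16) :* con 0ℚ :+ con (toℚ 16) :* y) :+ con (toℚ 9) :* (E :+ con (toℚ 6))
          := con (toℚ 4) :* (E :+ con (toℚ 10)) :* x :+ con (toℚ 16) :* y :+ con (toℚ 9) :* (E :+ con (toℚ 6))) refl

      weighted-hitting-from-a : toℚ 4 * (E + toℚ 6) * ∑[ i < n ] (δ i * M̂ a (old i)) ≡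
                                toℚ 4 * (E + toℚ 10) * A + toℚ 16 * B + toℚ 9 * (E + toℚ 6) * (E + toℚ 3)
      weighted-hitting-from-a = begin
        toℚ 4 * (E + toℚ 6) * ∑[ i < n ] (δ i * M̂ a (old i))
          ≡⟨ *-distribˡ-sum (toℚ 4 * (E + toℚ 6)) (λ i → δ i * M̂ a (old i)) ⟩
        ∑[ i < n ] (toℚ 4 * (E + toℚ 6) * (δ i * M̂ a (old i)))
          ≡⟨ sum-cong-≗ (λ i → trans (commute (toℚ 4 * (E + toℚ 6)) (δ i) (M̂ a (old i)))
                                     (cong (δ i *_) (hitting-Ghat-a-old i))) ⟩
        ∑[ i < n ] (δ i * (toℚ 4 * (E + toℚ 10) * M̄ V (old i) + toℚ 16 * M̄ (old i) V + toℚ 9 * (E + toℚ 6)))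
          ≡⟨ sum-cong-≗ (λ i → distribute (δ i) (toℚ 4 * (E + toℚ 10)) (M̄ V (old i)) (M̄ (old i) V)
                                          (toℚ 9 * (E + toℚ 6))) ⟩
        ∑[ i < n ] (toℚ 4 * (E + toℚ 10) * (δ i * M̄ V (old i)) + toℚ 16 * (δ i * M̄ (old i) V) + toℚ 9 * (E + toℚ 6) * δ i)
          ≡⟨ ∑-linear (toℚ 4 * (E + toℚ 10)) (toℚ 16) (toℚ 9 * (E + toℚ 6))
                      (λ i → δ i * M̄ V (old i)) (λ i → δ i * M̄ (old i) V) δ ⟩
        toℚ 4 * (E + toℚ 10) * A + toℚ 16 * B + toℚ 9 * (E + toℚ 6) * ∑[ i < n ] δ i
          ≡⟨ cong (λ d → toℚ 4 * (E + toℚ 10) * A + toℚ 16 * B + toℚ 9 * (E + toℚ 6) * d) (∑-deg-old true) ⟩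
        toℚ 4 * (E + toℚ 10) * A + toℚ 16 * B + toℚ 9 * (E + toℚ 6) * (E + toℚ 3)  ∎
        where
        open ≡-Reasoning
        commute : ∀ c d m → c * (d * m) ≡ d * (c * m)
        commute = solve 3 (λ c d m → c :* (d :* m) := d :* (c :* m)) refl
        distribute : ∀ d α x y γ → d * (α * x + toℚ 16 * y + γ) ≡ α * (d * x) + toℚ 16 * (d * y) + γ * d
        distribute = solve 5 (λ d α x y γ →
          d :* (α :* x :+ con (toℚ 16) :* y :+ γ) := α :* (d :* x) :+ con (toℚ 16) :* (d :* y) :+ γ :* d) refl

      kemeny-Ghat : ∀ {κ̂} → sumℚ (λ j → toℚ (deg Ĝ j) * M̂ a j) ≡ toℚ (twiceEdges Ĝ) * κ̂ →
                    toℚ 4 * (E + toℚ 6) * ((E + toℚ 10) * κ̂) ≡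
                    (E + toℚ 6) * (toℚ 16 * E + toℚ 94) + toℚ 4 * (E + toℚ 10) * A + toℚ 16 * B
      kemeny-Ghat {κ̂} row = begin
        toℚ 4 * (E + toℚ 6) * ((E + toℚ 10) * κ̂)
          ≡⟨ cong (λ m → toℚ 4 * (E + toℚ 6) * (m * κ̂)) twiceEdges-Ghat ⟨
        toℚ 4 * (E + toℚ 6) * (toℚ (twiceEdges Ĝ) * κ̂)
          ≡⟨ cong (toℚ 4 * (E + toℚ 6) *_) row ⟨
        toℚ 4 * (E + toℚ 6)
          * (toℚ (deg Ĝ a) * M̂ a a + (toℚ (deg Ĝ b) * M̂ a b + (toℚ (deg Ĝ c) * M̂ a c + sumℚ (λ i → δ i * M̂ a (old i)))))
          ≡⟨ cong (toℚ 4 * (E + toℚ 6) *_) (cong₂ _+_ (cong₂ _*_ toℚ-deg-Ghat-a (proj₁ hitting-Ĝ a))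
               (cong₂ _+_ (cong (_* M̂ a b) toℚ-deg-Ghat-b)
                 (cong₂ _+_ (cong (_* M̂ a c) toℚ-deg-Ghat-c) (sumℚ≡∑ (λ i → δ i * M̂ a (old i)))))) ⟩
        toℚ 4 * (E + toℚ 6) * (toℚ 2 * 0ℚ + (toℚ 3 * M̂ a b + (toℚ 2 * M̂ a c + S)))
          ≡⟨ expand E (M̂ a b) (M̂ a c) S ⟩
        toℚ 3 * (E + toℚ 6) * (toℚ 4 * M̂ a b) + (E + toℚ 6) * (toℚ 8 * M̂ a c) + toℚ 4 * (E + toℚ 6) * S
          ≡⟨ cong₂ _+_ (cong₂ (λ x y → toℚ 3 * (E + toℚ 6) * x + (E + toℚ 6) * y) hitting-Ghat-a-b hitting-Ghat-a-c)
                       weighted-hitting-from-a ⟩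
        toℚ 3 * (E + toℚ 6) * (E + toℚ 9) + (E + toℚ 6) * (toℚ 4 * E + toℚ 40)
          + (toℚ 4 * (E + toℚ 10) * A + toℚ 16 * B + toℚ 9 * (E + toℚ 6) * (E + toℚ 3))
          ≡⟨ collect E A B ⟩
        (E + toℚ 6) * (toℚ 16 * E + toℚ 94) + toℚ 4 * (E + toℚ 10) * A + toℚ 16 * B
          ∎
        where
        open ≡-Reasoning
        S : ℚ
        S = ∑[ i < n ] (δ i * M̂ a (old i))
        expand : ∀ E x y S → toℚ 4 * (E + toℚ 6) * (toℚ 2 * 0ℚ + (toℚ 3 * x + (toℚ 2 * y + S))) ≡
                             toℚ 3 * (E + toℚ 6) * (toℚ 4 * x) + (E + toℚ 6) * (toℚ 8 * y) + toℚ 4 * (E + toℚ 6) * S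
        expand = solve 4 (λ E x y S →
          con (toℚ 4) :* (E :+ con (toℚ 6)) :* (con (toℚ 2) :* con 0ℚ :+ (con (toℚ 3) :* x :+ (con (toℚ 2) :* y :+ S)))
          := con (toℚ 3) :* (E :+ con (toℚ 6)) :* (con (toℚ 4) :* x) :+ (E :+ con (toℚ 6)) :* (con (toℚ 8) :* y)
             :+ con (toℚ 4) :* (E :+ con (toℚ 6)) :* S) refl
        collect : ∀ E A B → toℚ 3 * (E + toℚ 6) * (E + toℚ 9) + (E + toℚ 6) * (toℚ 4 * E + toℚ 40)
                              + (toℚ 4 * (E + toℚ 10) * A + toℚ 16 * B + toℚ 9 * (E + toℚ 6) * (E + toℚ 3))
                            ≡ (E + toℚ 6) * (toℚ 16 * E + toℚ 94) + toℚ 4 * (E + toℚ 10) * A + toℚ 16 * B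
        collect = solve 3 (λ E A B →
          con (toℚ 3) :* (E :+ con (toℚ 6)) :* (E :+ con (toℚ 9)) :+ (E :+ con (toℚ 6)) :* (con (toℚ 4) :* E :+ con (toℚ 40))
            :+ (con (toℚ 4) :* (E :+ con (toℚ 10)) :* A :+ con (toℚ 16) :* B :+ con (toℚ 9) :* (E :+ con (toℚ 6)) :* (E :+ con (toℚ 3)))
          := (E :+ con (toℚ 6)) :* (con (toℚ 16) :* E :+ con (toℚ 94)) :+ con (toℚ 4) :* (E :+ con (toℚ 10)) :* A :+ con (toℚ 16) :* B) refl

      kemeny-difference : ∀ {κ̄ κ̂} →
        sumℚ (λ j → toℚ (deg Ḡ j) * M̄ a j) ≡ toℚ (twiceEdges Ḡ) * κ̄ →
        sumℚ (λ j → toℚ (deg Ĝ j) * M̂ a j) ≡ toℚ (twiceEdges Ĝ) * κ̂ →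
        toℚ 4 * (E + toℚ 6) * (E + toℚ 10) * κ̄ + ((E - toℚ 2) * (toℚ 4 * E + toℚ 18) + toℚ 16 * B)
          ≡ toℚ 4 * (E + toℚ 6) * (E + toℚ 10) * κ̂
      kemeny-difference {κ̄} {κ̂} row-Ḡ row-Ĝ = begin
        toℚ 4 * (E + toℚ 6) * (E + toℚ 10) * κ̄ + P
          ≡⟨ cong (_+ P) (regroup E κ̄) ⟩
        toℚ 4 * (E + toℚ 10) * ((E + toℚ 6) * κ̄) + P
          ≡⟨ cong (λ k → toℚ 4 * (E + toℚ 10) * k + P) (kemeny-Gbar row-Ḡ) ⟩
        toℚ 4 * (E + toℚ 10) * (toℚ 3 * E + toℚ 15 + A) + P
          ≡⟨ compare E A B ⟩
        (E + toℚ 6) * (toℚ 16 * E + toℚ 94) + toℚ 4 * (E + toℚ 10) * A + toℚ 16 * B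
          ≡⟨ kemeny-Ghat row-Ĝ ⟨
        toℚ 4 * (E + toℚ 6) * ((E + toℚ 10) * κ̂)
          ≡⟨ regroup′ E κ̂ ⟩
        toℚ 4 * (E + toℚ 6) * (E + toℚ 10) * κ̂
          ∎
        where
        open ≡-Reasoning
        P : ℚ
        P = (E - toℚ 2) * (toℚ 4 * E + toℚ 18) + toℚ 16 * B
        regroup : ∀ E κ → toℚ 4 * (E + toℚ 6) * (E + toℚ 10) * κ ≡ toℚ 4 * (E + toℚ 10) * ((E + toℚ 6) * κ)
        regroup = solve 2 (λ E κ →
          con (toℚ 4) :* (E :+ con (toℚ 6)) :* (E :+ con (toℚ 10)) :* κ
          := con (toℚ 4) :* (E :+ con (toℚ 10)) :* ((E :+ con (toℚ 6)) :* κ)) refl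
        regroup′ : ∀ E κ → toℚ 4 * (E + toℚ 6) * ((E + toℚ 10) * κ) ≡ toℚ 4 * (E + toℚ 6) * (E + toℚ 10) * κ
        regroup′ = solve 2 (λ E κ →
          con (toℚ 4) :* (E :+ con (toℚ 6)) :* ((E :+ con (toℚ 10)) :* κ)
          := con (toℚ 4) :* (E :+ con (toℚ 6)) :* (E :+ con (toℚ 10)) :* κ) refl
        compare : ∀ E A B → toℚ 4 * (E + toℚ 10) * (toℚ 3 * E + toℚ 15 + A) + ((E - toℚ 2) * (toℚ 4 * E + toℚ 18) + toℚ 16 * B)
                            ≡ (E + toℚ 6) * (toℚ 16 * E + toℚ 94) + toℚ 4 * (E + toℚ 10) * A + toℚ 16 * B
        compare = solve 3 (λ E A B →
          con (toℚ 4) :* (E :+ con (toℚ 10)) :* (con (toℚ 3) :* E :+ con (toℚ 15) :+ A)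
            :+ ((E :- con (toℚ 2)) :* (con (toℚ 4) :* E :+ con (toℚ 18)) :+ con (toℚ 16) :* B)
          := (E :+ con (toℚ 6)) :* (con (toℚ 16) :* E :+ con (toℚ 94)) :+ con (toℚ 4) :* (E :+ con (toℚ 10)) :* A :+ con (toℚ 16) :* B) refl

  two≤E : HasEdge G → toℚ 2 ≤ E
  two≤E (p , q , p~q) = subst (toℚ 2 ≤_) (sym (toℚ-sumℕ (deg G)))
    (ℚP.≤-trans (ℚP.+-mono-≤ (degree-positive G p~q) (degree-positive G q~p)) (pair≤∑ (degree-nonneg G) p≢q))
    where
    q~p : Adj G q p ≡ true
    q~p = trans (SimpleGraph.sym G q p) p~q
    p≢q : p ≢ q
    p≢q refl with trans (sym (loopless G p)) p~q
    ... | ()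

  kemeny-scale-nonneg : toℚ 2 ≤ E → 0ℚ ≤ toℚ 4 * (E + toℚ 6) * (E + toℚ 10)
  kemeny-scale-nonneg 2≤E =
    *-nonneg (*-nonneg (ℚP.nonNegative⁻¹ (toℚ 4)) (shifted (ℚP.nonNegative⁻¹ (toℚ 6))))
             (shifted (ℚP.nonNegative⁻¹ (toℚ 10)))
    where
    shifted : ∀ {k} → 0ℚ ≤ k → 0ℚ ≤ E + k
    shifted = ℚP.+-mono-≤ (ℚP.≤-trans (ℚP.nonNegative⁻¹ (toℚ 2)) 2≤E)

theorem4p15 : (n : ℕ) (G : SimpleGraph n) (v : Fin n) →
    Connected G → HasEdge G →
    (κbar κhat : ℚ) → IsKemeny (Gbar G v) κbar → IsKemeny (Ghat G v) κhat →
    κbar < κhat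
theorem4p15 n G v connected has-edge κbar κhat (M̄ , hitting-Ḡ , rows-Ḡ) (M̂ , hitting-Ĝ , rows-Ĝ) =
  gap⇒< (kemeny-scale-nonneg (two≤E has-edge))
        (kemeny-gap-positive hitting-Ḡ (two≤E has-edge) (one≤B hitting-Ḡ (connected-ext false connected) has-edge))
        (kemeny-difference hitting-Ḡ hitting-Ĝ (connected-ext true connected) (rows-Ḡ a) (rows-Ĝ a))
  where open Pendants G v
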